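{- Let $\alpha\in\mathbb{F}_q((z^{ -1}))$ be irrational and let $(P_k/Q_k)_{k\ge1}$ be the sequence of its convergents. Then $\alpha$ is singular on average if and only if $\|Q_k\|^{1/k}\to\infty$ as $k\to\infty$.
   Context: Let $q$ be a prime power, $\mathbb{F}_q[z]$ the polynomial ring over $\mathbb{F}_q$, $\mathbb{F}_q((z^{ -1}))$ the field of formal Laurent series $x=\sum_{i\ge-N}a_iz^{ -i}$, with $\|x\|=q^{\deg x}$ for $x\ne0$, $\|0\|=0$; irrational means not in $\mathbb{F}_q(z)$; the fractional part is $\{x\}=\sum_{i\ge1}a_iz^{ -i}$. Continued fraction: $\alpha=A_0+1/(A_1+1/(A_2+\cdots))$, $A_i\in\mathbb{F}_q[z]$, $\deg A_i\ge1$ for $i\ge1$; $Q_{ -1}=0$, $Q_0=1$, $Q_{k+1}=A_{k+1}Q_k+Q_{k-1}$ (and $P_k$ analogously with $P_{ -1}=1$, $P_0=A_0$). For $c>0$, $N\ge1$, $\Delta_{N,c}(\alpha)$ is the number of integers $l\in\{1,\dots,N\}$ for which $\|\{Q\alpha\}\|\le c2^{ -l}$ has a solution $Q\in\mathbb{F}_q[z]$ with $0<\|Q\|\le2^l$; $\alpha$ is singular on average if $\lim_{N\to\infty}\Delta_{N,c}(\alpha)/N=1$ for every $c>0$. -}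

module Defs where

open import Level using (0ℓ)
open import Algebra.Bundles using (CommutativeRing)
open import Data.Nat as ℕ using (ℕ; zero; suc; _≤ᵇ_; _<ᵇ_)
open import Data.Integer as ℤ using (ℤ; +_; -[1+_])
open import Data.Fin using (Fin)
open import Data.Bool using (if_then_else_)
open import Data.Product using (Σ; ∃; _×_; _,_; proj₂)
open import Relation.Nullary using (¬_)
open import Relation.Binary.Definitions using (Decidable)
open import Relation.Binary.PropositionalEquality using (_≡_)

record FiniteField : Set₁ where
  field
    cring    : CommutativeRing 0ℓ 0ℓ
  open CommutativeRing cring public
  field
    _≟_      : Decidable _≈_
    1≉0      : ¬ (1# ≈ 0#)
    inverse  : ∀ x → ¬ (x ≈ 0#) → ∃ λ y → (x * y) ≈ 1#
    q        : ℕ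
    enum     : Fin q → Carrier
    enum-inj : ∀ i j → enum i ≈ enum j → i ≡ j
    enum-sur : ∀ x → ∃ λ i → enum i ≈ x

module LaurentSeries (F : FiniteField) where
  open FiniteField F

  -- A formal Laurent series x = Σ_{i ≥ -N} a_i z^{-i} is stored as the
  -- shift N together with c m = a_{m-N} (m ∈ ℕ), i.e.
  -- x = Σ_{m ≥ 0} c m · z^{N - m}.
  record Laurent : Set where
    constructor laurent
    field
      shift : ℕ
      coef  : ℕ → Carrier
  open Laurent public

  -- a_i : the coefficient of z^{-i}  (i ∈ ℤ)
  coeffAt : Laurent → ℤ → Carrier
  coeffAt x i with i ℤ.+ (+ shift x)
  ... | + m      = coef x m
  ... | -[1+ _ ] = 0#

  _≈L_ : Laurent → Laurent → Set
  x ≈L y = ∀ i → coeffAt x i ≈ coeffAt y i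

  0L 1L : Laurent
  0L = laurent 0 (λ _ → 0#)
  1L = laurent 0 (λ { zero → 1# ; (suc _) → 0# })

  _+L_ : Laurent → Laurent → Laurent
  x +L y = laurent n (λ m → coeffAt x (+ m ℤ.- + n) + coeffAt y (+ m ℤ.- + n))
    where n = shift x ℕ.⊔ shift y

  sumTo : ℕ → (ℕ → Carrier) → Carrier
  sumTo zero    f = f 0
  sumTo (suc m) f = sumTo m f + f (suc m)

  _*L_ : Laurent → Laurent → Laurent
  x *L y = laurent (shift x ℕ.+ shift y)
                   (λ m → sumTo m (λ k → coef x k * coef y (m ℕ.∸ k)))

  -- polynomial part [x] = Σ_{i ≤ 0} a_i z^{-i}  and fractional part
  -- {x} = Σ_{i ≥ 1} a_i z^{-i}
  intPart : Laurent → Laurent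
  intPart x = laurent (shift x) (λ m → if m ≤ᵇ shift x then coef x m else 0#)

  frac : Laurent → Laurent
  frac x = laurent (shift x) (λ m → if shift x <ᵇ m then coef x m else 0#)

  IsPoly : Laurent → Set
  IsPoly x = ∀ (n : ℕ) → coeffAt x (+ suc n) ≈ 0#

  NonZeroL : Laurent → Set
  NonZeroL x = ∃ λ i → ¬ (coeffAt x i ≈ 0#)

  Irrational : Laurent → Set
  Irrational α = ¬ (Σ Laurent λ P → Σ Laurent λ Q →
                    IsPoly P × IsPoly Q × NonZeroL Q × ((Q *L α) ≈L P))

  -- Norms.  ‖a z^{-i}‖ = q^{-i} for a ≠ 0.
  -- QPowLe e a b : q^e ≤ a / b ;  QPowGe e a b : q^e ≥ a / b   (b > 0)
  QPowLe : ℤ → ℕ → ℕ → Set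
  QPowLe (+ n)     a b = b ℕ.* q ℕ.^ n ℕ.≤ a
  QPowLe -[1+ n ]  a b = b ℕ.≤ a ℕ.* q ℕ.^ suc n

  QPowGe : ℤ → ℕ → ℕ → Set
  QPowGe (+ n)     a b = a ℕ.≤ b ℕ.* q ℕ.^ n
  QPowGe -[1+ n ]  a b = a ℕ.* q ℕ.^ suc n ℕ.≤ b

  -- ‖x‖ ≤ a / b   (‖x‖ = max of q^{-i} over nonzero coefficients a_i; ‖0‖ = 0)
  NormLe : Laurent → ℕ → ℕ → Set
  NormLe x a b = ∀ i → ¬ (coeffAt x i ≈ 0#) → QPowLe (ℤ.- i) a b

  NormGe : Laurent → ℕ → ℕ → Set
  NormGe x a b = ∃ λ i → ¬ (coeffAt x i ≈ 0#) × QPowGe (ℤ.- i) a b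

  CompleteQuotients : Laurent → (ℕ → Laurent) → Set
  CompleteQuotients α αs =
    (αs 0 ≈L α) × (∀ k → (αs (suc k) *L frac (αs k)) ≈L 1L)

  module CF (αs : ℕ → Laurent) where
    A : ℕ → Laurent
    A k = intPart (αs k)

    -- (Q_{k-1}, Q_k) with Q_{-1} = 0, Q_0 = 1, Q_{k+1} = A_{k+1} Q_k + Q_{k-1}
    QQ : ℕ → Laurent × Laurent
    QQ zero    = 0L , 1L
    QQ (suc k) with QQ k
    ... | Qm , Qk = Qk , ((A (suc k) *L Qk) +L Qm)

    Q : ℕ → Laurent
    Q k = proj₂ (QQ k)

  -- Singular on average.
  -- Good a b α l : ‖{Qα}‖ ≤ c 2^{-l} (c = a/b) has a solution Q ∈ F_q[z]
  -- with 0 < ‖Q‖ ≤ 2^l.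
  Good : ℕ → ℕ → Laurent → ℕ → Set
  Good a b α l = Σ Laurent λ Q →
    IsPoly Q × NonZeroL Q × NormLe Q (2 ℕ.^ l) 1 ×
    NormLe (frac (Q *L α)) a (b ℕ.* 2 ℕ.^ l)

  -- Δ_{N,c}(α) ≥ m : there are m distinct l ∈ {1,…,N} that are Good.
  ΔAtLeast : ℕ → ℕ → Laurent → ℕ → ℕ → Set
  ΔAtLeast a b α N m = Σ (Fin m → ℕ) λ f →
    (∀ i j → f i ≡ f j → i ≡ j) ×
    (∀ i → (1 ℕ.≤ f i) × (f i ℕ.≤ N) × Good a b α (f i))

  -- lim Δ_{N,c}/N = 1 for every c = a/b > 0  (since Δ ≤ N this means:
  -- for every r, eventually Δ_{N,c} ≥ (r/(r+1)) N).
  SingularOnAverage : Laurent → Set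
  SingularOnAverage α = ∀ (a b : ℕ) → 1 ℕ.≤ a → 1 ℕ.≤ b → ∀ (r : ℕ) →
    ∃ λ N₀ → ∀ N → N₀ ℕ.≤ N → ∃ λ m →
      (r ℕ.* N ℕ.≤ m ℕ.* suc r) × ΔAtLeast a b α N m

  -- ‖Q_k‖^{1/k} → ∞ : for every M, eventually ‖Q_k‖ ≥ M^k.
  RootTendsToInfinity : (ℕ → Laurent) → Set
  RootTendsToInfinity Qs = ∀ (M : ℕ) → ∃ λ K → ∀ k → K ℕ.≤ k →
    NormGe (Qs k) (M ℕ.^ k) 1

-- Let d_k = deg Q_k, so that ‖Q_k‖ = q^(d_k) and, by the continued fraction recurrences,
-- ‖{Q_k α}‖ = q^(−d_{k+1}).  By the best approximation property of the convergents (a polynomial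
-- of degree below d_{k+1} leaves a fractional part at least as large as that of Q_k), a level l is
-- good for the constant c exactly when some convergent satisfies ‖Q_j‖ ≤ 2^l ≤ c ‖Q_{j+1}‖; so
-- everything becomes a statement about the integer sequence X_k = q^(d_k), which at least doubles.
-- If X_k^(1/k) → ∞, a level 2^l is bad only when it lies within a factor c of some X_j, and only
-- o(N) of the X_j are below 2^N, each spoiling O(log 1/c) levels: the bad levels have density 0.
-- Conversely, for c = 1/4 the level just below log₂ X_s is bad for every s ≥ 2, so if X_k < 2^(Mk)
-- for infinitely many k, at least k − 1 of the first Mk levels are bad, contradicting density 1.

{-# OPTIONS --safe #-}
module Submission where

open import Defs
open import Level using (0ℓ)
open import Algebra.Bundles using (CommutativeRing)
open import Data.Bool using (Bool; true; false; T; if_then_else_)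
open import Data.Empty using (⊥; ⊥-elim)
open import Data.Fin as Fin using (Fin; toℕ; fromℕ<)
import Data.Fin.Properties as FinP
open import Data.Integer as ℤ using (ℤ; +_; -[1+_]; _⊖_)
import Data.Integer.Properties as ℤP
open import Data.Integer.Tactic.RingSolver using (solve-∀)
open import Data.Nat as ℕ
  using (ℕ; zero; suc; z≤n; s≤s; _≤_; _<_; _∸_; _^_; _≤?_; _<?_)
import Data.Nat.Properties as ℕP
open import Data.Product using (Σ; ∃; _×_; _,_; proj₁; proj₂)
open import Data.Sum using (_⊎_; inj₁; inj₂)
open import Data.Unit using (tt)
open import Relation.Binary.Definitions using (tri<; tri≈; tri>)
open import Relation.Binary.PropositionalEquality as ≡ using (_≡_)
open import Relation.Nullary using (¬_; Dec; yes; no)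
open import Relation.Nullary.Decidable using (_×-dec_; ¬?)

module StrictlyIncreasing (f : ℕ → ℕ) (f-< : ∀ k → f k < f (suc k)) where

  n≤f[n] : ∀ n → n ≤ f n
  n≤f[n] zero    = z≤n
  n≤f[n] (suc n) = ℕP.≤-<-trans (n≤f[n] n) (f-< n)

  f-mono-≤ : ∀ {j k} → j ≤ k → f j ≤ f k
  f-mono-≤ {j} {zero}  z≤n = ℕP.≤-refl
  f-mono-≤ {j} {suc k} j≤1+k with ℕP.m≤n⇒m<n∨m≡n j≤1+k
  ... | inj₂ ≡.refl = ℕP.≤-refl
  ... | inj₁ j<1+k  = ℕP.≤-trans (f-mono-≤ (ℕP.≤-pred j<1+k)) (ℕP.<⇒≤ (f-< k))

  f-cancel-< : ∀ {j k} → f j < f k → j < k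
  f-cancel-< fj<fk = ℕP.≰⇒> (λ k≤j → ℕP.<⇒≱ fj<fk (f-mono-≤ k≤j))

  bracket : ∀ t → f 0 ≤ t → ∃ λ j → f j ≤ t × t < f (suc j)
  bracket t f0≤t = search (suc t) 0 f0≤t (s≤s ℕP.≤-refl)
    where
    search : ∀ fuel n → f n ≤ t → t < n ℕ.+ fuel → ∃ λ j → f j ≤ t × t < f (suc j)
    search zero    n fn≤t t<n =
      ⊥-elim (ℕP.<⇒≱ (≡.subst (t <_) (ℕP.+-identityʳ n) t<n) (ℕP.≤-trans (n≤f[n] n) fn≤t))
    search (suc k) n fn≤t t<n+k with f (suc n) ≤? t
    ... | no  fn+1≰t = n , fn≤t , ℕP.≰⇒> fn+1≰t
    ... | yes fn+1≤t = search k (suc n) fn+1≤t (≡.subst (t <_) (ℕP.+-suc n k) t<n+k)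

n<2^n : ∀ n → n < 2 ^ n
n<2^n zero    = s≤s z≤n
n<2^n (suc n) = ≡.subst₂ _≤_ (ℕP.+-comm (suc n) 1) (≡.cong (2 ^ n ℕ.+_) (≡.sym (ℕP.+-identityʳ (2 ^ n))))
                          (ℕP.+-mono-≤ (n<2^n n) (ℕP.m^n>0 2 n))

^-cancelʳ-< : ∀ m .{{_ : ℕ.NonZero m}} {a b} → m ^ a < m ^ b → a < b
^-cancelʳ-< m m^a<m^b = ℕP.≰⇒> (λ b≤a → ℕP.<⇒≱ m^a<m^b (ℕP.^-monoʳ-≤ m b≤a))

^-cancelʳ-≤ : ∀ m → 1 < m → ∀ {a b} → m ^ a ≤ m ^ b → a ≤ b
^-cancelʳ-≤ m 1<m m^a≤m^b = ℕP.≮⇒≥ (λ b<a → ℕP.<⇒≱ (ℕP.^-monoʳ-< m 1<m b<a) m^a≤m^b)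

b*2^l<2^[b+l] : ∀ b l → b ℕ.* 2 ^ l < 2 ^ (b ℕ.+ l)
b*2^l<2^[b+l] b l = ≡.subst (b ℕ.* 2 ^ l <_) (≡.sym (ℕP.^-distribˡ-+-* 2 b l))
  (ℕP.*-monoˡ-< (2 ^ l) {{ℕ.>-nonZero (ℕP.m^n>0 2 l)}} (n<2^n b))

2^-< : ∀ k → 2 ^ k < 2 ^ suc k
2^-< k = ℕP.^-monoʳ-< 2 (s≤s (s≤s z≤n)) (ℕP.n<1+n k)

⌊log₂⌋-bracket : ∀ X → 1 ≤ X → ∃ λ p → 2 ^ p ≤ X × X < 2 ^ suc p
⌊log₂⌋-bracket = StrictlyIncreasing.bracket (2 ^_) 2^-<

m<k+n∧k≤m⇒m∸k<n : ∀ m k n → m < k ℕ.+ n → k ≤ m → m ∸ k < n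
m<k+n∧k≤m⇒m∸k<n m k n m<k+n k≤m =
  ≡.subst (m ∸ k <_) (ℕP.m+n∸m≡n k n) (ℕP.∸-monoˡ-< m<k+n k≤m)

j+n<m∧k≤j⇒n<m∸k : ∀ m k j n → j ℕ.+ n < m → k ≤ j → n < m ∸ k
j+n<m∧k≤j⇒n<m∸k m k j n j+n<m k≤j = ℕP.<-≤-trans
  (≡.subst (_< m ∸ j) (ℕP.m+n∸n≡m n j)
    (ℕP.∸-monoˡ-< (≡.subst (_< m) (ℕP.+-comm j n) j+n<m) (ℕP.m≤n+m j n)))
  (ℕP.∸-monoʳ-≤ m k≤j)

module Counting where
  open import Data.Nat using (_+_; _*_)

  𝟙 : ∀ {A : Set} → Dec A → ℕ
  𝟙 (yes _) = 1
  𝟙 (no _)  = 0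

  count : ∀ {P : ℕ → Set} → (∀ l → Dec (P l)) → ℕ → ℕ
  count P? zero    = 0
  count P? (suc N) = 𝟙 (P? (suc N)) + count P? N

  InjectiveFamily : (ℕ → Set) → ℕ → ℕ → Set
  InjectiveFamily P N m =
    Σ (Fin m → ℕ) λ f → (∀ i j → f i ≡ f j → i ≡ j) × (∀ i → 1 ≤ f i × f i ≤ N × P (f i))

  module _ {P : ℕ → Set} (P? : ∀ l → Dec (P l)) where

    count-complement : ∀ N → count P? N + count (λ l → ¬? (P? l)) N ≡ N
    count-complement zero = ≡.refl
    count-complement (suc N) with P? (suc N)
    ... | yes _ = ≡.cong suc (count-complement N)
    ... | no  _ = ≡.trans (ℕP.+-suc (count P? N) _) (≡.cong suc (count-complement N))

    count-mono : ∀ {N M} → N ≤ M → count P? N ≤ count P? M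
    count-mono {N} {zero}  z≤n = z≤n
    count-mono {N} {suc M} N≤1+M with ℕP.m≤n⇒m<n∨m≡n N≤1+M
    ... | inj₂ ≡.refl = ℕP.≤-refl
    ... | inj₁ N<1+M  = ℕP.≤-trans (count-mono (ℕP.≤-pred N<1+M)) (ℕP.m≤n+m (count P? M) (𝟙 (P? (suc M))))

    count-hit : ∀ l → P (suc l) → count P? (suc l) ≡ suc (count P? l)
    count-hit l p with P? (suc l)
    ... | yes _ = ≡.refl
    ... | no ¬p = ⊥-elim (¬p p)

    -- Ranking l ↦ count P? (l − 1) embeds the family into Fin (count P? N).
    injectiveFamily⇒≤count : ∀ N m → InjectiveFamily P N m → m ≤ count P? N
    injectiveFamily⇒≤count N m (f , f-inj , f-in) = FinP.injective⇒≤ {f = rank-of} rank-of-injective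
      where
      rank : ∀ l → 1 ≤ l → l ≤ N → P l → count P? (l ∸ 1) < count P? N
      rank (suc l) _ l<N p = ≡.subst (_≤ count P? N) (count-hit l p) (count-mono l<N)
      rank-injective : ∀ l l′ → 1 ≤ l → P l → 1 ≤ l′ → P l′ →
                       count P? (l ∸ 1) ≡ count P? (l′ ∸ 1) → l ≡ l′
      rank-injective (suc l) (suc l′) _ p _ p′ same with ℕP.<-cmp l l′
      ... | tri≈ _ l≡l′ _ = ≡.cong suc l≡l′
      ... | tri< l<l′ _ _ =
        ⊥-elim (ℕP.<-irrefl same (≡.subst (_≤ count P? l′) (count-hit l p) (count-mono l<l′)))
      ... | tri> _ _ l′<l =
        ⊥-elim (ℕP.<-irrefl (≡.sym same) (≡.subst (_≤ count P? l) (count-hit l′ p′) (count-mono l′<l)))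
      rank-of : Fin m → Fin (count P? N)
      rank-of i = fromℕ< (rank (f i) (proj₁ (f-in i)) (proj₁ (proj₂ (f-in i))) (proj₂ (proj₂ (f-in i))))
      rank-of-injective : ∀ {i j} → rank-of i ≡ rank-of j → i ≡ j
      rank-of-injective {i} {j} eq = f-inj i j (rank-injective (f i) (f j)
        (proj₁ (f-in i)) (proj₂ (proj₂ (f-in i))) (proj₁ (f-in j)) (proj₂ (proj₂ (f-in j)))
        (≡.trans (≡.sym (FinP.toℕ-fromℕ< _)) (≡.trans (≡.cong toℕ eq) (FinP.toℕ-fromℕ< _))))

    count-enumeration : ∀ N → InjectiveFamily P N (count P? N)
    count-enumeration zero = (λ ()) , (λ ()) , (λ ())
    count-enumeration (suc N) with P? (suc N) | count-enumeration N
    ... | no _  | f , f-inj , f-in = f , f-inj , λ i → proj₁ (f-in i) , ℕP.m≤n⇒m≤1+n (proj₁ (proj₂ (f-in i))) ,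
                                                        proj₂ (proj₂ (f-in i))
    ... | yes p | f , f-inj , f-in = g , g-inj , g-in
      where
      g : Fin (suc (count P? N)) → ℕ
      g Fin.zero    = suc N
      g (Fin.suc i) = f i
      g-inj : ∀ i j → g i ≡ g j → i ≡ j
      g-inj Fin.zero    Fin.zero    _  = ≡.refl
      g-inj Fin.zero    (Fin.suc j) eq = ⊥-elim (ℕP.<-irrefl (≡.sym eq) (s≤s (proj₁ (proj₂ (f-in j)))))
      g-inj (Fin.suc i) Fin.zero    eq = ⊥-elim (ℕP.<-irrefl eq (s≤s (proj₁ (proj₂ (f-in i)))))
      g-inj (Fin.suc i) (Fin.suc j) eq = ≡.cong Fin.suc (f-inj i j eq)
      g-in : ∀ i → 1 ≤ g i × g i ≤ suc N × P (g i)
      g-in Fin.zero    = s≤s z≤n , ℕP.≤-refl , p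
      g-in (Fin.suc i) = proj₁ (f-in i) , ℕP.m≤n⇒m≤1+n (proj₁ (proj₂ (f-in i))) , proj₂ (proj₂ (f-in i))

  count-⊆ : ∀ {P Q : ℕ → Set} (P? : ∀ l → Dec (P l)) (Q? : ∀ l → Dec (Q l)) N →
            (∀ l → 1 ≤ l → l ≤ N → P l → Q l) → count P? N ≤ count Q? N
  count-⊆ P? Q? zero    P⊆Q = z≤n
  count-⊆ P? Q? (suc N) P⊆Q
    with P? (suc N) | Q? (suc N) | count-⊆ P? Q? N (λ l 1≤l l≤N → P⊆Q l 1≤l (ℕP.m≤n⇒m≤1+n l≤N))
  ... | yes p | no ¬q | _  = ⊥-elim (¬q (P⊆Q (suc N) (s≤s z≤n) ℕP.≤-refl p))
  ... | yes _ | yes _ | ih = s≤s ih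
  ... | no _  | yes _ | ih = ℕP.m≤n⇒m≤1+n ih
  ... | no _  | no _  | ih = ih

  sumBelow : ℕ → (ℕ → ℕ) → ℕ
  sumBelow zero    g = 0
  sumBelow (suc J) g = sumBelow J g + g J

  sumBelow-+ : ∀ J g h → sumBelow J (λ j → g j + h j) ≡ sumBelow J g + sumBelow J h
  sumBelow-+ zero    g h = ≡.refl
  sumBelow-+ (suc J) g h = ≡.trans (≡.cong (_+ (g J + h J)) (sumBelow-+ J g h))
                                   (+-interchange (sumBelow J g) (sumBelow J h) (g J) (h J))
    where
    open import Data.Nat.Solver using (module +-*-Solver)
    open +-*-Solver
    +-interchange : ∀ a b c d → (a + b) + (c + d) ≡ (a + c) + (b + d)
    +-interchange = solve 4 (λ a b c d → (a :+ b) :+ (c :+ d) := (a :+ c) :+ (b :+ d)) ≡.refl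

  sumBelow-≤ : ∀ J g c → (∀ j → j < J → g j ≤ c) → sumBelow J g ≤ J * c
  sumBelow-≤ zero    g c g≤c = z≤n
  sumBelow-≤ (suc J) g c g≤c = ≡.subst (sumBelow J g + g J ≤_) (ℕP.+-comm (J * c) c)
    (ℕP.+-mono-≤ (sumBelow-≤ J g c (λ j j<J → g≤c j (ℕP.m≤n⇒m≤1+n j<J))) (g≤c J ℕP.≤-refl))

  sumBelow-≥ : ∀ J g j → j < J → g j ≤ sumBelow J g
  sumBelow-≥ (suc J) g j j<1+J with ℕP.m≤n⇒m<n∨m≡n (ℕP.≤-pred j<1+J)
  ... | inj₁ j<J    = ℕP.≤-trans (sumBelow-≥ J g j j<J) (ℕP.m≤m+n _ _)
  ... | inj₂ ≡.refl = ℕP.m≤n+m _ _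

  count-union : ∀ {P : ℕ → Set} {Q : ℕ → ℕ → Set} (P? : ∀ l → Dec (P l)) (Q? : ∀ j l → Dec (Q j l)) J N →
    (∀ l → 1 ≤ l → l ≤ N → P l → ∃ λ j → j < J × Q j l) → count P? N ≤ sumBelow J (λ j → count (Q? j) N)
  count-union P? Q? J zero    P⊆⋃Q = z≤n
  count-union P? Q? J (suc N) P⊆⋃Q = begin
    𝟙 (P? (suc N)) + count P? N
      ≤⟨ ℕP.+-mono-≤ hit (count-union P? Q? J N λ l 1≤l l≤N → P⊆⋃Q l 1≤l (ℕP.m≤n⇒m≤1+n l≤N)) ⟩
    sumBelow J (λ j → 𝟙 (Q? j (suc N))) + sumBelow J (λ j → count (Q? j) N)
      ≡⟨ ≡.sym (sumBelow-+ J _ _) ⟩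
    sumBelow J (λ j → count (Q? j) (suc N)) ∎
    where
    open ℕP.≤-Reasoning
    hit : 𝟙 (P? (suc N)) ≤ sumBelow J (λ j → 𝟙 (Q? j (suc N)))
    hit with P? (suc N)
    ... | no _  = z≤n
    ... | yes p with P⊆⋃Q (suc N) (s≤s z≤n) ℕP.≤-refl p
    ...   | j , j<J , q = ℕP.≤-trans (one (Q? j (suc N)) q) (sumBelow-≥ J _ j j<J)
      where
      one : ∀ {A : Set} (A? : Dec A) → A → 1 ≤ 𝟙 A?
      one (yes _) _ = ℕP.≤-refl
      one (no ¬a) a = ⊥-elim (¬a a)

  module Window (p b : ℕ) where
    window? : ∀ l → Dec ((p < l + b) × (l ≤ p))
    window? l = (p <? l + b) ×-dec (l ≤? p)

    private
      count≤N∸[p∸b] : ∀ N → count window? N ≤ N ∸ (p ∸ b)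
      count≤N∸[p∸b] zero = z≤n
      count≤N∸[p∸b] (suc N) with window? (suc N)
      ... | no _ = ℕP.≤-trans (count≤N∸[p∸b] N) (ℕP.∸-monoˡ-≤ (p ∸ b) (ℕP.n≤1+n N))
      ... | yes (p<N+1+b , _) = ≡.subst (suc (count window? N) ≤_) (≡.sym (ℕP.+-∸-assoc 1 p∸b≤N))
                                        (s≤s (count≤N∸[p∸b] N))
        where
        p∸b≤N : p ∸ b ≤ N
        p∸b≤N = ℕP.≤-trans (ℕP.∸-monoˡ-≤ b (ℕP.≤-pred p<N+1+b)) (ℕP.≤-reflexive (ℕP.m+n∸n≡m N b))

      count-beyond-p : ∀ k → count window? (p + k) ≡ count window? p
      count-beyond-p zero    = ≡.cong (count window?) (ℕP.+-identityʳ p)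
      count-beyond-p (suc k) = ≡.trans (≡.cong (count window?) (ℕP.+-suc p k)) (≡.trans miss (count-beyond-p k))
        where
        miss : count window? (suc (p + k)) ≡ count window? (p + k)
        miss with window? (suc (p + k))
        ... | no _ = ≡.refl
        ... | yes (_ , p+k<p) = ⊥-elim (ℕP.<-irrefl ≡.refl (ℕP.≤-trans (s≤s (ℕP.m≤m+n p k)) p+k<p))

      p∸[p∸b]≤b : p ∸ (p ∸ b) ≤ b
      p∸[p∸b]≤b with ℕP.≤-total b p
      ... | inj₁ b≤p = ℕP.≤-reflexive (ℕP.m∸[m∸n]≡n b≤p)
      ... | inj₂ p≤b = ≡.subst (_≤ b) (≡.sym (≡.cong (p ∸_) (ℕP.m≤n⇒m∸n≡0 p≤b))) p≤b

    count-window : ∀ N → count window? N ≤ b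
    count-window N with ℕP.≤-total N p
    ... | inj₁ N≤p = ℕP.≤-trans (count≤N∸[p∸b] N) (ℕP.≤-trans (ℕP.∸-monoˡ-≤ (p ∸ b) N≤p) p∸[p∸b]≤b)
    ... | inj₂ p≤N = ≡.subst (_≤ b) (≡.sym (≡.trans (≡.cong (count window?) (≡.sym (ℕP.m+[n∸m]≡n p≤N)))
                                                     (count-beyond-p (N ∸ p))))
                               (ℕP.≤-trans (count≤N∸[p∸b] p) p∸[p∸b]≤b)

-- X k stands for ‖Q_k‖ = q^(deg Q_k); then ‖{Q_k α}‖ = 1 / X (k+1), and level l is good for
-- c = a/b with witness Q_j exactly when GoodAt a b l j.
module Density (X : ℕ → ℕ) (X₀≡1 : X 0 ≡ 1) (X-double : ∀ k → 2 ℕ.* X k ≤ X (suc k)) where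
  open import Data.Nat using (_+_; _*_)
  open import Data.Nat.DivMod using (_/_; m/n*n≤m; m*n/n≡m; /-monoˡ-≤)
  open import Data.Nat.Solver using (module +-*-Solver)
  open +-*-Solver
  open Counting

  1≤X : ∀ k → 1 ≤ X k
  1≤X zero    = ℕP.≤-reflexive (≡.sym X₀≡1)
  1≤X (suc k) = ℕP.≤-trans (ℕP.≤-trans (1≤X k) (ℕP.m≤m+n (X k) (X k ℕ.+ 0))) (X-double k)

  x<2x : ∀ x → 1 ≤ x → x < 2 * x
  x<2x x 1≤x = ≡.subst (x <_) (≡.cong (ℕ._+_ x) (≡.sym (ℕP.+-identityʳ x)))
                 (≡.subst (_≤ x + x) (ℕP.+-comm x 1) (ℕP.+-monoʳ-≤ x 1≤x))

  X-< : ∀ k → X k < X (suc k)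
  X-< k = ℕP.<-≤-trans (x<2x (X k) (1≤X k)) (X-double k)

  open StrictlyIncreasing X X-< using (bracket) renaming (f-mono-≤ to X-mono-≤; f-cancel-< to X-cancel-<)

  2^k≤X : ∀ k → 2 ^ k ≤ X k
  2^k≤X zero    = 1≤X 0
  2^k≤X (suc k) = ℕP.≤-trans (ℕP.*-monoʳ-≤ 2 (2^k≤X k)) (X-double k)

  2X≤X : ∀ {j k} → j < k → 2 * X j ≤ X k
  2X≤X {j} {suc k} j<1+k = ℕP.≤-trans (X-double j) (X-mono-≤ j<1+k)

  GoodAt : ℕ → ℕ → ℕ → ℕ → Set
  GoodAt a b l j = (X j ≤ 2 ^ l) × (b * 2 ^ l ≤ a * X (suc j))

  GoodAt? : ∀ a b l j → Dec (GoodAt a b l j)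
  GoodAt? a b l j = (X j ≤? 2 ^ l) ×-dec (b * 2 ^ l ≤? a * X (suc j))

  SuperExponential : Set
  SuperExponential = ∀ M → ∃ λ K → ∀ k → K ≤ k → M ^ k ≤ X k

  DenselyGood : (ℕ → ℕ → ℕ → Set) → Set
  DenselyGood G = ∀ (a b : ℕ) → 1 ≤ a → 1 ≤ b → ∀ (r : ℕ) →
    ∃ λ N₀ → ∀ N → N₀ ≤ N → ∃ λ m → (r * N ≤ m * suc r) × InjectiveFamily (G a b) N m

  ⌊log₂X⌋ : ℕ → ℕ
  ⌊log₂X⌋ s = proj₁ (⌊log₂⌋-bracket (X s) (1≤X s))

  2^⌊log₂X⌋≤X : ∀ s → 2 ^ ⌊log₂X⌋ s ≤ X s
  2^⌊log₂X⌋≤X s = proj₁ (proj₂ (⌊log₂⌋-bracket (X s) (1≤X s)))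

  X<2^[1+⌊log₂X⌋] : ∀ s → X s < 2 ^ suc (⌊log₂X⌋ s)
  X<2^[1+⌊log₂X⌋] s = proj₂ (proj₂ (⌊log₂⌋-bracket (X s) (1≤X s)))

  few-bad⇒dense : ∀ r N B m → B + m ≡ N → suc r * B ≤ N → r * N ≤ m * suc r
  few-bad⇒dense r N B m B+m≡N [1+r]B≤N = ≡.subst (r * N ≤_) (ℕP.*-comm (suc r) m)
    (ℕP.+-cancelˡ-≤ (suc r * B) (r * N) (suc r * m) (begin
      suc r * B + r * N  ≤⟨ ℕP.+-monoˡ-≤ (r * N) [1+r]B≤N ⟩
      N + r * N          ≡⟨ ≡.cong (suc r *_) (≡.sym B+m≡N) ⟩
      suc r * (B + m)    ≡⟨ ℕP.*-distribˡ-+ (suc r) B m ⟩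
      suc r * B + suc r * m ∎))
    where
    open ℕP.≤-Reasoning

  module FixedConstant (a b : ℕ) (1≤a : 1 ≤ a) (1≤b : 1 ≤ b) where

    Straddles : ℕ → ℕ → Set
    Straddles j l = (2 ^ l < X j) × (X j < b * 2 ^ l)

    Straddles? : ∀ j l → Dec (Straddles j l)
    Straddles? j l = (2 ^ l <? X j) ×-dec (X j <? b * 2 ^ l)

    Bad : ℕ → Set
    Bad l = ∃ λ j → j < b + l × Straddles j l

    Bad? : ∀ l → Dec (Bad l)
    Bad? l = ℕP.anyUpTo? (λ j → Straddles? j l) (b + l)

    -- With X j ≤ 2^l < X (j+1), the level l fails only if X (j+1) straddles b 2^l.
    ¬Bad⇒goodAt : ∀ l → ¬ Bad l → ∃ (GoodAt a b l)
    ¬Bad⇒goodAt l ¬bad with bracket (2 ^ l) (ℕP.≤-trans (ℕP.≤-reflexive X₀≡1) (ℕP.m^n>0 2 l))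
    ... | j , Xj≤2^l , 2^l<Xj+1 with X (suc j) <? b * 2 ^ l
    ...   | yes Xj+1<b2^l = ⊥-elim (¬bad (suc j , j+1<b+l , 2^l<Xj+1 , Xj+1<b2^l))
      where
      j+1<b+l : suc j < b + l
      j+1<b+l = ^-cancelʳ-< 2 (ℕP.≤-<-trans (2^k≤X (suc j)) (ℕP.<-trans Xj+1<b2^l (b*2^l<2^[b+l] b l)))
    ...   | no  Xj+1≮b2^l = j , Xj≤2^l , ℕP.≤-trans (ℕP.≮⇒≥ Xj+1≮b2^l)
              (≡.subst (_≤ a * X (suc j)) (ℕP.*-identityˡ (X (suc j))) (ℕP.*-monoˡ-≤ (X (suc j)) 1≤a))

    count-straddles : ∀ j N → count (Straddles? j) N ≤ b
    count-straddles j N = ℕP.≤-trans (count-⊆ (Straddles? j) window? N (λ l _ _ → in-window l))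
                                     (count-window N)
      where
      open Window (⌊log₂X⌋ j) b
      in-window : ∀ l → Straddles j l → (⌊log₂X⌋ j < l + b) × (l ≤ ⌊log₂X⌋ j)
      in-window l (2^l<Xj , Xj<b2^l) =
        ≡.subst (⌊log₂X⌋ j <_) (ℕP.+-comm b l)
          (^-cancelʳ-< 2 (ℕP.≤-<-trans (2^⌊log₂X⌋≤X j) (ℕP.<-≤-trans Xj<b2^l (ℕP.<⇒≤ (b*2^l<2^[b+l] b l))))) ,
        ℕP.≤-pred (^-cancelʳ-< 2 (ℕP.<-trans 2^l<Xj (X<2^[1+⌊log₂X⌋] j)))

    slope : ℕ → ℕ
    slope r = suc (2 * b * suc r)

    private
      bad-count-arithmetic : ∀ r K Y N → Y * slope r ≤ b + N → 2 * suc K * b * suc r + b ≤ N →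
                             suc r * ((suc K + Y) * b) ≤ N
      bad-count-arithmetic r K Y N Y*T≤b+N N₀≤N = ℕP.*-cancelˡ-≤ 2 (begin
        2 * (suc r * ((suc K + Y) * b))                         ≡⟨ expand r K Y b ⟩
        C + Y * (2 * b * suc r)                                 ≤⟨ ℕP.+-monoʳ-≤ C (ℕP.m≤n+m _ Y) ⟩
        C + (Y + Y * (2 * b * suc r))                           ≡⟨ ≡.cong (ℕ._+_ C) (≡.sym (ℕP.*-suc Y (2 * b * suc r))) ⟩
        C + Y * slope r                                         ≤⟨ ℕP.+-monoʳ-≤ C Y*T≤b+N ⟩
        C + (b + N)                                             ≡⟨ ≡.sym (ℕP.+-assoc C b N) ⟩
        (C + b) + N                                             ≤⟨ ℕP.+-monoˡ-≤ N N₀≤N ⟩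
        N + N                                                   ≡⟨ ≡.cong (ℕ._+_ N) (≡.sym (ℕP.+-identityʳ N)) ⟩
        2 * N                                                   ∎)
        where
        open ℕP.≤-Reasoning
        C : ℕ
        C = 2 * suc K * b * suc r
        expand : ∀ r K Y b → 2 * (suc r * ((suc K + Y) * b)) ≡ 2 * suc K * b * suc r + Y * (2 * b * suc r)
        expand = solve 4 (λ r K Y b → con 2 :* ((con 1 :+ r) :* (((con 1 :+ K) :+ Y) :* b))
                                   := con 2 :* (con 1 :+ K) :* b :* (con 1 :+ r) :+ Y :* (con 2 :* b :* (con 1 :+ r))) ≡.refl

    -- Past K, X j ≥ 2^(slope r · j), so only about N / slope r values of j can straddle a level ≤ N.
    bad-count-bound : ∀ r K → (∀ k → K ≤ k → 2 ^ (slope r * k) ≤ X k) →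
                      ∀ N → 2 * suc K * b * suc r + b ≤ N → suc r * count Bad? N ≤ N
    bad-count-bound r K X-large N N₀≤N = ℕP.≤-trans
      (ℕP.*-monoʳ-≤ (suc r) (ℕP.≤-trans (count-union Bad? Straddles? (suc K + Y) N relevant)
                                        (sumBelow-≤ (suc K + Y) _ b (λ j _ → count-straddles j N))))
      (bad-count-arithmetic r K Y N (m/n*n≤m (b + N) (slope r)) N₀≤N)
      where
      Y : ℕ
      Y = (b + N) / slope r
      relevant : ∀ l → 1 ≤ l → l ≤ N → Bad l → ∃ λ j → j < suc K + Y × Straddles j l
      relevant l _ l≤N (j , _ , straddles) with j <? K
      ... | yes j<K = j , ℕP.<-≤-trans j<K (ℕP.≤-trans (ℕP.n≤1+n K) (ℕP.m≤m+n (suc K) Y)) , straddles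
      ... | no  j≮K = j , ℕP.≤-trans (s≤s j≤Y) (ℕP.≤-trans (ℕP.m≤n+m (suc Y) K) (ℕP.≤-reflexive (ℕP.+-suc K Y))) ,
                      straddles
        where
        T*j<b+N : slope r * j < b + N
        T*j<b+N = ^-cancelʳ-< 2 (ℕP.≤-<-trans (X-large j (ℕP.≮⇒≥ j≮K))
          (ℕP.<-≤-trans (proj₂ straddles) (ℕP.≤-trans (ℕP.*-monoʳ-≤ b (ℕP.^-monoʳ-≤ 2 l≤N))
                                                       (ℕP.<⇒≤ (b*2^l<2^[b+l] b N)))))
        j≤Y : j ≤ Y
        j≤Y = ≡.subst (_≤ Y) (m*n/n≡m j (slope r))
                (/-monoˡ-≤ (slope r) (ℕP.≤-trans (ℕP.≤-reflexive (ℕP.*-comm j (slope r))) (ℕP.<⇒≤ T*j<b+N)))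

  superExponential⇒denselyGood : ∀ G → (∀ a b l j → GoodAt a b l j → G a b l) → SuperExponential → DenselyGood G
  superExponential⇒denselyGood G goodAt⇒G superExp a b 1≤a 1≤b r = N₀ , dense
    where
    open FixedConstant a b 1≤a 1≤b
    K : ℕ
    K = proj₁ (superExp (2 ^ slope r))
    X-large : ∀ k → K ≤ k → 2 ^ (slope r * k) ≤ X k
    X-large k K≤k = ≡.subst (_≤ X k) (ℕP.^-*-assoc 2 (slope r) k) (proj₂ (superExp (2 ^ slope r)) k K≤k)
    N₀ : ℕ
    N₀ = 2 * suc K * b * suc r + b
    dense : ∀ N → N₀ ≤ N → ∃ λ m → (r * N ≤ m * suc r) × InjectiveFamily (G a b) N m
    dense N N₀≤N with count-enumeration (λ l → ¬? (Bad? l)) N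
    ... | f , f-inj , f-in = count (λ l → ¬? (Bad? l)) N ,
      few-bad⇒dense r N (count Bad? N) _ (count-complement Bad? N) (bad-count-bound r K X-large N N₀≤N) ,
      f , f-inj , λ i → proj₁ (f-in i) , proj₁ (proj₂ (f-in i)) ,
        goodAt⇒G a b (f i) _ (proj₂ (¬Bad⇒goodAt (f i) (proj₂ (proj₂ (f-in i)))))

  Good¼ : ℕ → Set
  Good¼ l = ∃ λ j → j < suc l × GoodAt 1 4 l j

  Good¼? : ∀ l → Dec (Good¼ l)
  Good¼? l = ℕP.anyUpTo? (λ j → GoodAt? 1 4 l j) (suc l)

  ⌊log₂X⌋-mono-< : ∀ {s s′} → s < s′ → ⌊log₂X⌋ s < ⌊log₂X⌋ s′
  ⌊log₂X⌋-mono-< {s} {s′} s<s′ = ℕP.≤-pred (^-cancelʳ-< 2 (ℕP.≤-<-trans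
    (ℕP.≤-trans (ℕP.*-monoʳ-≤ 2 (2^⌊log₂X⌋≤X s)) (2X≤X s<s′)) (X<2^[1+⌊log₂X⌋] s′)))

  2≤⌊log₂X⌋ : ∀ s → 2 ≤ s → 2 ≤ ⌊log₂X⌋ s
  2≤⌊log₂X⌋ s 2≤s = ℕP.≤-pred (^-cancelʳ-< 2 (ℕP.≤-<-trans (ℕP.≤-trans (ℕP.^-monoʳ-≤ 2 2≤s) (2^k≤X s))
                                                         (X<2^[1+⌊log₂X⌋] s)))

  -- 2^(p−1) with p = ⌊log₂ X s⌋ has no witness for c = 1/4: X_j ≤ 2^(p−1) forces j < s,
  -- and then 4 · 2^(p−1) = 2^(p+1) > X s ≥ X (j+1).
  ¬Good¼-below-X : ∀ s → 2 ≤ s → ¬ Good¼ (⌊log₂X⌋ s ∸ 1)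
  ¬Good¼-below-X s 2≤s (j , _ , Xj≤2^[p-1] , 4*2^[p-1]≤Xj+1) = ℕP.<⇒≱ Xj+1<4*2^[p-1] 4*2^[p-1]≤Xj+1
    where
    p : ℕ
    p = ⌊log₂X⌋ s
    2≤p : 2 ≤ p
    2≤p = 2≤⌊log₂X⌋ s 2≤s
    2^[1+p]≡4*2^[p-1] : ∀ p → 2 ≤ p → 2 ^ suc p ≡ 4 * 2 ^ (p ∸ 1)
    2^[1+p]≡4*2^[p-1] (suc zero) (s≤s ())
    2^[1+p]≡4*2^[p-1] (suc (suc p)) _ = ≡.sym (ℕP.*-assoc 2 2 (2 ^ suc p))
    j<s : j < s
    j<s = X-cancel-< (ℕP.≤-<-trans Xj≤2^[p-1]
      (ℕP.<-≤-trans (ℕP.^-monoʳ-< 2 (s≤s (s≤s z≤n)) (ℕP.∸-monoʳ-< {p} {1} {0} (s≤s z≤n) 1≤p)) (2^⌊log₂X⌋≤X s)))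
      where
      1≤p : 1 ≤ p
      1≤p = ℕP.≤-trans (s≤s z≤n) 2≤p
    Xj+1<4*2^[p-1] : 1 * X (suc j) < 4 * 2 ^ (p ∸ 1)
    Xj+1<4*2^[p-1] = ≡.subst₂ _<_ (≡.sym (ℕP.*-identityˡ _)) (2^[1+p]≡4*2^[p-1] p 2≤p)
                       (ℕP.≤-<-trans (X-mono-≤ j<s) (X<2^[1+⌊log₂X⌋] s))

  bad-levels : ∀ k N → 1 ≤ k → X k < 2 ^ N → InjectiveFamily (λ l → ¬ Good¼ l) N (k ∸ 1)
  bad-levels k N 1≤k Xk<2^N = level , level-injective , level-in
    where
    s : Fin (k ∸ 1) → ℕ
    s i = suc (suc (toℕ i))
    2≤s : ∀ i → 2 ≤ s i
    2≤s i = s≤s (s≤s z≤n)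
    s≤k : ∀ i → s i ≤ k
    s≤k i = ℕP.≤-trans (s≤s (FinP.toℕ<n i)) (ℕP.≤-reflexive (ℕP.m+[n∸m]≡n 1≤k))
    level : Fin (k ∸ 1) → ℕ
    level i = ⌊log₂X⌋ (s i) ∸ 1
    level-< : ∀ {i i′} → toℕ i < toℕ i′ → level i < level i′
    level-< {i} i<i′ =
      ℕP.∸-monoˡ-< (⌊log₂X⌋-mono-< (s≤s (s≤s i<i′))) (ℕP.≤-trans (s≤s z≤n) (2≤⌊log₂X⌋ (s i) (2≤s i)))
    level-injective : ∀ i i′ → level i ≡ level i′ → i ≡ i′
    level-injective i i′ eq with ℕP.<-cmp (toℕ i) (toℕ i′)
    ... | tri≈ _ i≡i′ _ = FinP.toℕ-injective i≡i′
    ... | tri< i<i′ _ _ = ⊥-elim (ℕP.<-irrefl eq (level-< i<i′))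
    ... | tri> _ _ i′<i = ⊥-elim (ℕP.<-irrefl (≡.sym eq) (level-< i′<i))
    level-in : ∀ i → 1 ≤ level i × level i ≤ N × ¬ Good¼ (level i)
    level-in i = ℕP.∸-monoˡ-≤ 1 (2≤⌊log₂X⌋ (s i) (2≤s i)) ,
                 ℕP.≤-trans (ℕP.m∸n≤m (⌊log₂X⌋ (s i)) 1)
                   (ℕP.<⇒≤ (^-cancelʳ-< 2 (ℕP.≤-<-trans (2^⌊log₂X⌋≤X (s i)) (ℕP.≤-<-trans (X-mono-≤ (s≤k i)) Xk<2^N)))) ,
                 ¬Good¼-below-X (s i) (2≤s i)

  private
    density-contradiction : ∀ M k m → 3 ≤ k → suc (2 * M) * (suc M * k) ≤ m * suc (suc (2 * M)) →
                            m + (k ∸ 1) ≤ suc M * k → ⊥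
    density-contradiction M (suc zero)       m (s≤s ()) _ _
    density-contradiction M (suc (suc zero)) m (s≤s (s≤s ())) _ _
    density-contradiction M (suc (suc (suc k))) m _ dense m+k-1≤N = ℕP.<⇒≱ k+3<2k+4 2k+4≤k+3
      where
      open ℕP.≤-Reasoning
      K r : ℕ
      K = suc (suc (suc k))
      r = suc (2 * M)
      k+3<2k+4 : K < 2 * suc (suc k)
      k+3<2k+4 = ≡.subst (K <_) (solve 1 (λ k → (con 3 :+ k) :+ (con 1 :+ k) := con 2 :* (con 2 :+ k)) ≡.refl k)
                           (ℕP.m<m+n K (s≤s z≤n))
      rK≤2m : r * K ≤ 2 * m
      rK≤2m = ℕP.*-cancelˡ-≤ (suc M) (≡.subst₂ _≤_
        (solve 2 (λ M k → (con 1 :+ con 2 :* M) :* ((con 1 :+ M) :* (con 3 :+ k))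
                       := (con 1 :+ M) :* ((con 1 :+ con 2 :* M) :* (con 3 :+ k))) ≡.refl M k)
        (solve 2 (λ M m → m :* (con 2 :+ con 2 :* M) := (con 1 :+ M) :* (con 2 :* m)) ≡.refl M m)
        dense)
      2k+4≤k+3 : 2 * suc (suc k) ≤ K
      2k+4≤k+3 = ℕP.+-cancelˡ-≤ (2 * m) _ _ (begin
        2 * m + 2 * suc (suc k) ≡⟨ ≡.sym (ℕP.*-distribˡ-+ 2 m (suc (suc k))) ⟩
        2 * (m + suc (suc k))   ≤⟨ ℕP.*-monoʳ-≤ 2 m+k-1≤N ⟩
        2 * (suc M * K)         ≡⟨ solve 2 (λ M k → con 2 :* ((con 1 :+ M) :* (con 3 :+ k))
                                                 := (con 1 :+ con 2 :* M) :* (con 3 :+ k) :+ (con 3 :+ k)) ≡.refl M k ⟩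
        r * K + K               ≤⟨ ℕP.+-monoˡ-≤ K rK≤2m ⟩
        2 * m + K               ∎)

  -- If X k < 2^((M+1)k), the k − 1 bad levels of bad-levels leave too few good levels
  -- for density 1 − 1/(2M+2).
  denselyGood⇒superExponential : ∀ G → (∀ a b l → G a b l → ∃ (GoodAt a b l)) → DenselyGood G → SuperExponential
  denselyGood⇒superExponential G G⇒goodAt dense M = N₀ + 3 , X-large
    where
    r N₀ : ℕ
    r = suc (2 * M)
    N₀ = proj₁ (dense 1 4 (s≤s z≤n) (s≤s z≤n) r)
    X-large : ∀ k → N₀ + 3 ≤ k → M ^ k ≤ X k
    X-large k N₀+3≤k with (2 ^ suc M) ^ k ≤? X k
    ... | yes big = ℕP.≤-trans (ℕP.^-monoˡ-≤ k (ℕP.<⇒≤ (ℕP.<-≤-trans (n<2^n M) (ℕP.^-monoʳ-≤ 2 (ℕP.n≤1+n M))))) big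
    ... | no ¬big with proj₂ (dense 1 4 (s≤s z≤n) (s≤s z≤n) r) (suc M * k)
                            (ℕP.≤-trans (ℕP.m≤m+n N₀ 3) (ℕP.≤-trans N₀+3≤k (ℕP.m≤m+n k (M * k))))
    ...   | m , r*N≤m*[1+r] , (f , f-inj , f-in) = ⊥-elim (density-contradiction M k m 3≤k r*N≤m*[1+r]
              (ℕP.≤-trans (ℕP.+-mono-≤ m≤#good k-1≤#bad) (ℕP.≤-reflexive (count-complement Good¼? (suc M * k)))))
      where
      3≤k : 3 ≤ k
      3≤k = ℕP.≤-trans (ℕP.m≤n+m 3 N₀) N₀+3≤k
      Xk<2^N : X k < 2 ^ (suc M * k)
      Xk<2^N = ≡.subst (X k <_) (ℕP.^-*-assoc 2 (suc M) k) (ℕP.≰⇒> ¬big)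
      G⇒Good¼ : ∀ l → G 1 4 l → Good¼ l
      G⇒Good¼ l g with G⇒goodAt 1 4 l g
      ... | j , Xj≤2^l , rest = j , s≤s (^-cancelʳ-≤ 2 (s≤s (s≤s z≤n)) (ℕP.≤-trans (2^k≤X j) Xj≤2^l)) , Xj≤2^l , rest
      m≤#good : m ≤ count Good¼? (suc M * k)
      m≤#good = injectiveFamily⇒≤count Good¼? (suc M * k) m
        (f , f-inj , λ i → proj₁ (f-in i) , proj₁ (proj₂ (f-in i)) , G⇒Good¼ (f i) (proj₂ (proj₂ (f-in i))))
      k-1≤#bad : k ∸ 1 ≤ count (λ l → ¬? (Good¼? l)) (suc M * k)
      k-1≤#bad = injectiveFamily⇒≤count (λ l → ¬? (Good¼? l)) (suc M * k) (k ∸ 1)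
                   (bad-levels k (suc M * k) (ℕP.≤-trans (s≤s z≤n) 3≤k) Xk<2^N)

module FiniteSums (F : FiniteField) where
  open FiniteField F hiding (zero)
  open LaurentSeries F using (sumTo)
  open import Relation.Binary.Reasoning.Setoid setoid

  sumTo-cong≤ : ∀ n {f g : ℕ → Carrier} → (∀ k → k ≤ n → f k ≈ g k) → sumTo n f ≈ sumTo n g
  sumTo-cong≤ zero    f≈g = f≈g 0 z≤n
  sumTo-cong≤ (suc n) f≈g =
    +-cong (sumTo-cong≤ n (λ k k≤n → f≈g k (ℕP.m≤n⇒m≤1+n k≤n))) (f≈g (suc n) ℕP.≤-refl)

  sumTo-cong : ∀ n {f g : ℕ → Carrier} → (∀ k → f k ≈ g k) → sumTo n f ≈ sumTo n g
  sumTo-cong n f≈g = sumTo-cong≤ n (λ k _ → f≈g k)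

  sumTo-zero : ∀ n (f : ℕ → Carrier) → (∀ k → k ≤ n → f k ≈ 0#) → sumTo n f ≈ 0#
  sumTo-zero zero    f f≈0 = f≈0 0 z≤n
  sumTo-zero (suc n) f f≈0 = trans
    (+-cong (sumTo-zero n f (λ k k≤n → f≈0 k (ℕP.m≤n⇒m≤1+n k≤n))) (f≈0 (suc n) ℕP.≤-refl))
    (+-identityˡ 0#)

  sumTo-≉0 : ∀ n f → ¬ (sumTo n f ≈ 0#) → ∃ λ k → k ≤ n × ¬ (f k ≈ 0#)
  sumTo-≉0 zero    f sum≉0 = 0 , z≤n , sum≉0
  sumTo-≉0 (suc n) f sum≉0 with f (suc n) ≟ 0#
  ... | no fn≉0 = suc n , ℕP.≤-refl , fn≉0
  ... | yes fn≈0 with sumTo-≉0 n f (λ s≈0 → sum≉0 (trans (+-cong s≈0 fn≈0) (+-identityˡ 0#)))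
  ...   | k , k≤n , fk≉0 = k , ℕP.m≤n⇒m≤1+n k≤n , fk≉0

  sumTo-+ : ∀ n (f g : ℕ → Carrier) → sumTo n (λ k → f k + g k) ≈ sumTo n f + sumTo n g
  sumTo-+ zero    f g = refl
  sumTo-+ (suc n) f g = begin
    sumTo n (λ k → f k + g k) + (f (suc n) + g (suc n)) ≈⟨ +-congʳ (sumTo-+ n f g) ⟩
    (sumTo n f + sumTo n g) + (f (suc n) + g (suc n))   ≈⟨ +-assoc _ _ _ ⟩
    sumTo n f + (sumTo n g + (f (suc n) + g (suc n)))   ≈⟨ +-congˡ (sym (+-assoc _ _ _)) ⟩
    sumTo n f + ((sumTo n g + f (suc n)) + g (suc n))   ≈⟨ +-congˡ (+-congʳ (+-comm _ _)) ⟩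
    sumTo n f + ((f (suc n) + sumTo n g) + g (suc n))   ≈⟨ +-congˡ (+-assoc _ _ _) ⟩
    sumTo n f + (f (suc n) + (sumTo n g + g (suc n)))   ≈⟨ sym (+-assoc _ _ _) ⟩
    (sumTo n f + f (suc n)) + (sumTo n g + g (suc n))   ∎

  *-distribˡ-sumTo : ∀ n c (f : ℕ → Carrier) → c * sumTo n f ≈ sumTo n (λ k → c * f k)
  *-distribˡ-sumTo zero    c f = refl
  *-distribˡ-sumTo (suc n) c f = trans (distribˡ _ _ _) (+-congʳ (*-distribˡ-sumTo n c f))

  *-distribʳ-sumTo : ∀ n c (f : ℕ → Carrier) → sumTo n f * c ≈ sumTo n (λ k → f k * c)
  *-distribʳ-sumTo zero    c f = refl
  *-distribʳ-sumTo (suc n) c f = trans (distribʳ _ _ _) (+-congʳ (*-distribʳ-sumTo n c f))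

  sumTo-suc : ∀ n (f : ℕ → Carrier) → sumTo (suc n) f ≈ f 0 + sumTo n (λ k → f (suc k))
  sumTo-suc zero    f = refl
  sumTo-suc (suc n) f = trans (+-congʳ (sumTo-suc n f)) (+-assoc _ _ _)

  sumTo-single : ∀ n p (f : ℕ → Carrier) → p ≤ n →
                 (∀ k → k ≤ n → ¬ (k ≡ p) → f k ≈ 0#) → sumTo n f ≈ f p
  sumTo-single zero .zero f z≤n _ = refl
  sumTo-single (suc n) p f p≤1+n others≈0 with p ℕ.≟ suc n
  ... | yes ≡.refl = trans
    (+-congʳ (sumTo-zero n f λ k k≤n → others≈0 k (ℕP.m≤n⇒m≤1+n k≤n) (ℕP.<⇒≢ (s≤s k≤n))))
    (+-identityˡ _)
  ... | no p≢1+n = trans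
    (+-congˡ (others≈0 (suc n) ℕP.≤-refl (λ e → p≢1+n (≡.sym e))))
    (trans (+-identityʳ _)
      (sumTo-single n p f (ℕP.≤-pred (ℕP.≤∧≢⇒< p≤1+n p≢1+n))
        (λ k k≤n → others≈0 k (ℕP.m≤n⇒m≤1+n k≤n))))

  sumTo-reverse : ∀ n (f : ℕ → Carrier) → sumTo n f ≈ sumTo n (λ k → f (n ∸ k))
  sumTo-reverse zero    f = refl
  sumTo-reverse (suc n) f = begin
    sumTo n f + f (suc n)                           ≈⟨ +-congʳ (sumTo-reverse n f) ⟩
    sumTo n (λ k → f (n ∸ k)) + f (suc n)           ≈⟨ +-comm _ _ ⟩
    f (suc n) + sumTo n (λ k → f (suc n ∸ suc k))   ≈⟨ sym (sumTo-suc n (λ k → f (suc n ∸ k))) ⟩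
    sumTo (suc n) (λ k → f (suc n ∸ k))             ∎

  sumTo-triangle : ∀ n (g : ℕ → ℕ → Carrier) →
    sumTo n (λ k → sumTo k (λ j → g j k)) ≈ sumTo n (λ j → sumTo (n ∸ j) (λ t → g j (j ℕ.+ t)))
  sumTo-triangle zero    g = refl
  sumTo-triangle (suc n) g = begin
    sumTo n (λ k → sumTo k (λ j → g j k)) + sumTo (suc n) (λ j → g j (suc n))
      ≈⟨ +-congʳ (sumTo-triangle n g) ⟩
    sumTo n rows + (sumTo n (λ j → g j (suc n)) + g (suc n) (suc n))
      ≈⟨ sym (+-assoc _ _ _) ⟩
    (sumTo n rows + sumTo n (λ j → g j (suc n))) + g (suc n) (suc n)
      ≈⟨ +-congʳ (sym (sumTo-+ n _ _)) ⟩
    sumTo n (λ j → rows j + g j (suc n)) + g (suc n) (suc n)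
      ≈⟨ +-cong (sumTo-cong≤ n extend-row) (reflexive (≡.cong (g (suc n)) (≡.sym (ℕP.+-identityʳ (suc n))))) ⟩
    sumTo n rows′ + g (suc n) (suc n ℕ.+ 0)
      ≈⟨ +-congˡ (reflexive (≡.cong (λ m → sumTo m (λ t → g (suc n) (suc n ℕ.+ t)))
                                   (≡.sym (ℕP.n∸n≡0 (suc n))))) ⟩
    sumTo (suc n) rows′ ∎
    where
    rows rows′ : ℕ → Carrier
    rows  j = sumTo (n ∸ j) (λ t → g j (j ℕ.+ t))
    rows′ j = sumTo (suc n ∸ j) (λ t → g j (j ℕ.+ t))
    extend-row : ∀ j → j ≤ n → rows j + g j (suc n) ≈ rows′ j
    extend-row j j≤n rewrite ℕP.+-∸-assoc 1 j≤n = +-congˡ (reflexive (≡.cong (g j) (≡.sym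
      (≡.trans (ℕP.+-suc j (n ∸ j)) (≡.cong suc (ℕP.m+[n∸m]≡n j≤n))))))

  infixl 7 _⋆_

  _⋆_ : (ℕ → Carrier) → (ℕ → Carrier) → ℕ → Carrier
  (a ⋆ b) m = sumTo m (λ k → a k * b (m ∸ k))

  ⋆-cong : ∀ a a′ b b′ → (∀ k → a k ≈ a′ k) → (∀ k → b k ≈ b′ k) →
           ∀ m → (a ⋆ b) m ≈ (a′ ⋆ b′) m
  ⋆-cong _ _ _ _ a≈a′ b≈b′ m = sumTo-cong m (λ k → *-cong (a≈a′ k) (b≈b′ (m ∸ k)))

  ⋆-comm : ∀ a b m → (a ⋆ b) m ≈ (b ⋆ a) m
  ⋆-comm a b m = trans (sumTo-reverse m _) (sumTo-cong≤ m λ k k≤m →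
    trans (*-comm _ _) (*-congʳ (reflexive (≡.cong b (ℕP.m∸[m∸n]≡n k≤m)))))

  ⋆-distribˡ : ∀ a b c m → (a ⋆ (λ k → b k + c k)) m ≈ (a ⋆ b) m + (a ⋆ c) m
  ⋆-distribˡ a b c m = trans (sumTo-cong m (λ k → distribˡ _ _ _)) (sumTo-+ m _ _)

  ⋆-assoc : ∀ a b c n → ((a ⋆ b) ⋆ c) n ≈ (a ⋆ (b ⋆ c)) n
  ⋆-assoc a b c n = begin
    sumTo n (λ k → sumTo k (λ j → a j * b (k ∸ j)) * c (n ∸ k))
      ≈⟨ sumTo-cong n (λ k → *-distribʳ-sumTo k _ _) ⟩
    sumTo n (λ k → sumTo k (λ j → a j * b (k ∸ j) * c (n ∸ k)))
      ≈⟨ sumTo-triangle n (λ j k → a j * b (k ∸ j) * c (n ∸ k)) ⟩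
    sumTo n (λ j → sumTo (n ∸ j) (λ t → a j * b ((j ℕ.+ t) ∸ j) * c (n ∸ (j ℕ.+ t))))
      ≈⟨ sumTo-cong n (λ j → sumTo-cong (n ∸ j) (λ t → trans (*-assoc _ _ _) (*-congˡ (*-cong
           (reflexive (≡.cong b (ℕP.m+n∸m≡n j t)))
           (reflexive (≡.cong c (≡.sym (ℕP.∸-+-assoc n j t)))))))) ⟩
    sumTo n (λ j → sumTo (n ∸ j) (λ t → a j * (b t * c ((n ∸ j) ∸ t))))
      ≈⟨ sumTo-cong n (λ j → sym (*-distribˡ-sumTo (n ∸ j) _ _)) ⟩
    (a ⋆ (b ⋆ c)) n ∎

  δ₀ : ℕ → Carrier
  δ₀ zero    = 1#
  δ₀ (suc _) = 0#

  ⋆-identityˡ : ∀ b m → (δ₀ ⋆ b) m ≈ b m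
  ⋆-identityˡ b m = trans
    (sumTo-single m 0 _ z≤n λ { zero _ k≢0 → ⊥-elim (k≢0 ≡.refl) ; (suc k) _ _ → zeroˡ _ })
    (*-identityˡ _)

  ⋆-vanishes-below : ∀ a b p p′ → (∀ k → k < p → a k ≈ 0#) → (∀ k → k < p′ → b k ≈ 0#) →
                     ∀ n → n < p ℕ.+ p′ → (a ⋆ b) n ≈ 0#
  ⋆-vanishes-below a b p p′ a≈0 b≈0 n n<p+p′ = sumTo-zero n _ term≈0
    where
    term≈0 : ∀ k → k ≤ n → a k * b (n ∸ k) ≈ 0#
    term≈0 k k≤n with k <? p
    ... | yes k<p = trans (*-congʳ (a≈0 k k<p)) (zeroˡ _)
    ... | no  k≮p = trans (*-congˡ (b≈0 (n ∸ k) (m<k+n∧k≤m⇒m∸k<n n k p′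
            (ℕP.<-≤-trans n<p+p′ (ℕP.+-monoˡ-≤ p′ (ℕP.≮⇒≥ k≮p))) k≤n))) (zeroʳ _)

  ⋆-vanishes-above : ∀ a b p p′ → (∀ k → p < k → a k ≈ 0#) → (∀ k → p′ < k → b k ≈ 0#) →
                     ∀ n → p ℕ.+ p′ < n → (a ⋆ b) n ≈ 0#
  ⋆-vanishes-above a b p p′ a≈0 b≈0 n p+p′<n = sumTo-zero n _ (λ k _ → term≈0 k)
    where
    term≈0 : ∀ k → a k * b (n ∸ k) ≈ 0#
    term≈0 k with p <? k
    ... | yes p<k = trans (*-congʳ (a≈0 k p<k)) (zeroˡ _)
    ... | no  p≮k =
      trans (*-congˡ (b≈0 (n ∸ k) (j+n<m∧k≤j⇒n<m∸k n k p p′ p+p′<n (ℕP.≮⇒≥ p≮k)))) (zeroʳ _)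

  ⋆-leading : ∀ a b p p′ → (∀ k → k < p → a k ≈ 0#) → (∀ k → k < p′ → b k ≈ 0#) →
              (a ⋆ b) (p ℕ.+ p′) ≈ a p * b p′
  ⋆-leading a b p p′ a≈0 b≈0 = trans
    (sumTo-single (p ℕ.+ p′) p _ (ℕP.m≤m+n p p′) other≈0)
    (*-congˡ (reflexive (≡.cong b (ℕP.m+n∸m≡n p p′))))
    where
    other≈0 : ∀ k → k ≤ p ℕ.+ p′ → ¬ (k ≡ p) → a k * b ((p ℕ.+ p′) ∸ k) ≈ 0#
    other≈0 k k≤ k≢p with ℕP.<-cmp k p
    ... | tri< k<p _ _ = trans (*-congʳ (a≈0 k k<p)) (zeroˡ _)
    ... | tri≈ _ k≡p _ = ⊥-elim (k≢p k≡p)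
    ... | tri> _ _ p<k = trans (*-congˡ (b≈0 _ (m<k+n∧k≤m⇒m∸k<n (p ℕ.+ p′) k p′ (ℕP.+-monoˡ-< p′ p<k) k≤)))
                               (zeroʳ _)

  delay : ℕ → (ℕ → Carrier) → ℕ → Carrier
  delay zero    a         = a
  delay (suc s) a zero    = 0#
  delay (suc s) a (suc k) = delay s a k

  delay-cong : ∀ s {a b} → (∀ k → a k ≈ b k) → ∀ n → delay s a n ≈ delay s b n
  delay-cong zero    a≈b n       = a≈b n
  delay-cong (suc s) a≈b zero    = refl
  delay-cong (suc s) a≈b (suc n) = delay-cong s a≈b n

  delay-+ : ∀ s t a n → delay s (delay t a) n ≡ delay (s ℕ.+ t) a n
  delay-+ zero    t a n       = ≡.refl
  delay-+ (suc s) t a zero    = ≡.refl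
  delay-+ (suc s) t a (suc n) = delay-+ s t a n

  ⋆-delayˡ : ∀ s a b n → (delay s a ⋆ b) n ≈ delay s (a ⋆ b) n
  ⋆-delayˡ zero    a b n       = refl
  ⋆-delayˡ (suc s) a b zero    = zeroˡ _
  ⋆-delayˡ (suc s) a b (suc n) = begin
    (delay (suc s) a ⋆ b) (suc n)                            ≈⟨ sumTo-suc n _ ⟩
    0# * b (suc n) + sumTo n (λ k → delay s a k * b (n ∸ k)) ≈⟨ trans (+-congʳ (zeroˡ _)) (+-identityˡ _) ⟩
    (delay s a ⋆ b) n                                        ≈⟨ ⋆-delayˡ s a b n ⟩
    delay s (a ⋆ b) n                                        ∎

  ⋆-delay : ∀ s t a b n → (delay s a ⋆ delay t b) n ≈ delay (s ℕ.+ t) (a ⋆ b) n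
  ⋆-delay s t a b n = begin
    (delay s a ⋆ delay t b) n  ≈⟨ ⋆-delayˡ s a (delay t b) n ⟩
    delay s (a ⋆ delay t b) n  ≈⟨ delay-cong s delay-right n ⟩
    delay s (delay t (a ⋆ b)) n ≡⟨ delay-+ s t (a ⋆ b) n ⟩
    delay (s ℕ.+ t) (a ⋆ b) n  ∎
    where
    delay-right : ∀ k → (a ⋆ delay t b) k ≈ delay t (a ⋆ b) k
    delay-right k = trans (⋆-comm a (delay t b) k)
      (trans (⋆-delayˡ t b a k) (delay-cong t (⋆-comm b a) k))

n-m+m≡n : ∀ (n m : ℤ) → (n ℤ.- m) ℤ.+ m ≡ n
n-m+m≡n = solve-∀

n+m-m≡n : ∀ (n m : ℤ) → (n ℤ.+ m) ℤ.- m ≡ n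
n+m-m≡n = solve-∀

module LaurentArithmetic (F : FiniteField) where
  open FiniteField F hiding (zero)
  open LaurentSeries F
  open FiniteSums F
  open import Algebra.Properties.Ring ring using (-0#≈0#)
  open import Relation.Binary.Reasoning.Setoid setoid

  atℤ : (ℕ → Carrier) → ℤ → Carrier
  atℤ f (+ m)    = f m
  atℤ f -[1+ _ ] = 0#

  coeffAt≡atℤ : ∀ x i → coeffAt x i ≡ atℤ (coef x) (i ℤ.+ + shift x)
  coeffAt≡atℤ x i with i ℤ.+ + shift x
  ... | + m      = ≡.refl
  ... | -[1+ _ ] = ≡.refl

  coeffAt-below : ∀ x i k → i ℤ.+ + shift x ≡ -[1+ k ] → coeffAt x i ≈ 0#
  coeffAt-below x i k eq rewrite coeffAt≡atℤ x i | eq = refl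

  coeffAt-coef : ∀ x i m → i ℤ.+ + shift x ≡ + m → coeffAt x i ≡ coef x m
  coeffAt-coef x i m eq rewrite coeffAt≡atℤ x i | eq = ≡.refl

  -- An index i either is n − M for a natural n, or lies below −N for every N ≤ M,
  -- where the coefficients of a series of shift N vanish.
  data IndexView (M : ℕ) (i : ℤ) : Set where
    within : ∀ n → i ≡ + n ℤ.- + M → i ℤ.+ + M ≡ + n → IndexView M i
    below  : (∀ N → N ≤ M → ∃ λ k → i ℤ.+ + N ≡ -[1+ k ]) → IndexView M i

  indexView : ∀ M i → IndexView M i
  indexView M i with i ℤ.+ + M in eq
  ... | + n      = within n (≡.trans (≡.sym (n+m-m≡n i (+ M))) (≡.cong (ℤ._- + M) eq)) eq
  ... | -[1+ k ] = below λ N N≤M → negative N k N≤M eq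
    where
    negative : ∀ N k → N ≤ M → i ℤ.+ + M ≡ -[1+ k ] → ∃ λ k′ → i ℤ.+ + N ≡ -[1+ k′ ]
    negative N k N≤M eqM with i ℤ.+ + N in eqN
    ... | -[1+ k′ ] = k′ , ≡.refl
    ... | + n with ≡.subst₂ ℤ._≤_ eqN eqM (ℤP.+-monoʳ-≤ i (ℤ.+≤+ N≤M))
    ...   | ()

  -- coefs M x n is the coefficient of z^(M − n): the coefficients of x read with shift M.
  coefs : ℕ → Laurent → ℕ → Carrier
  coefs M x n = coeffAt x (+ n ℤ.- + M)

  coefs-cong : ∀ M {x y} → x ≈L y → ∀ n → coefs M x n ≈ coefs M y n
  coefs-cong M x≈y n = x≈y (+ n ℤ.- + M)

  coefs-delay : ∀ M x → shift x ≤ M → ∀ n → coefs M x n ≡ delay (M ∸ shift x) (coef x) n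
  coefs-delay M x N≤M n =
    ≡.trans (≡.cong (λ K → coefs K x n) (≡.sym (ℕP.m∸n+n≡m N≤M)))
    (≡.trans (coeffAt≡atℤ x (+ n ℤ.- + (s ℕ.+ shift x)))
    (≡.trans (≡.cong (atℤ (coef x)) (≡.trans (cancel (+ n) (+ s) (+ shift x)) (ℤP.m-n≡m⊖n n s)))
    (≡.sym (delay≡atℤ s n))))
    where
    s = M ∸ shift x
    cancel : ∀ (n M N : ℤ) → (n ℤ.- (M ℤ.+ N)) ℤ.+ N ≡ n ℤ.- M
    cancel = solve-∀
    delay≡atℤ : ∀ s n → delay s (coef x) n ≡ atℤ (coef x) (n ⊖ s)
    delay≡atℤ zero    n       = ≡.refl
    delay≡atℤ (suc s) zero    = ≡.refl
    delay≡atℤ (suc s) (suc n) =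
      ≡.trans (delay≡atℤ s n) (≡.cong (atℤ (coef x)) (≡.sym (ℤP.[1+m]⊖[1+n]≡m⊖n n s)))

  ≈L-by-coefs : ∀ M x y → shift x ≤ M → shift y ≤ M → (∀ n → coefs M x n ≈ coefs M y n) → x ≈L y
  ≈L-by-coefs M x y x≤M y≤M same i with indexView M i
  ... | within n i≡ _ rewrite i≡ = same n
  ... | below neg with neg (shift x) x≤M | neg (shift y) y≤M
  ...   | k , eqx | k′ , eqy = trans (coeffAt-below x i k eqx) (sym (coeffAt-below y i k′ eqy))

  coefs-* : ∀ M₁ M₂ x y → shift x ≤ M₁ → shift y ≤ M₂ → ∀ n →
            coefs (M₁ ℕ.+ M₂) (x *L y) n ≈ (coefs M₁ x ⋆ coefs M₂ y) n
  coefs-* M₁ M₂ x y x≤M₁ y≤M₂ n = begin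
    coefs (M₁ ℕ.+ M₂) (x *L y) n
      ≡⟨ coefs-delay (M₁ ℕ.+ M₂) (x *L y) (ℕP.+-mono-≤ x≤M₁ y≤M₂) n ⟩
    delay (M₁ ℕ.+ M₂ ∸ (shift x ℕ.+ shift y)) (coef x ⋆ coef y) n
      ≡⟨ ≡.cong (λ s → delay s (coef x ⋆ coef y) n) ∸-split ⟩
    delay ((M₁ ∸ shift x) ℕ.+ (M₂ ∸ shift y)) (coef x ⋆ coef y) n
      ≈⟨ sym (⋆-delay (M₁ ∸ shift x) (M₂ ∸ shift y) (coef x) (coef y) n) ⟩
    (delay (M₁ ∸ shift x) (coef x) ⋆ delay (M₂ ∸ shift y) (coef y)) n
      ≈⟨ ⋆-cong _ (coefs M₁ x) _ (coefs M₂ y) (λ k → reflexive (≡.sym (coefs-delay M₁ x x≤M₁ k)))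
                (λ k → reflexive (≡.sym (coefs-delay M₂ y y≤M₂ k))) n ⟩
    (coefs M₁ x ⋆ coefs M₂ y) n ∎
    where
    ∸-split : M₁ ℕ.+ M₂ ∸ (shift x ℕ.+ shift y) ≡ (M₁ ∸ shift x) ℕ.+ (M₂ ∸ shift y)
    ∸-split = ≡.trans (≡.sym (ℕP.∸-+-assoc (M₁ ℕ.+ M₂) (shift x) (shift y)))
      (≡.trans (≡.cong (_∸ shift y) (ℕP.+-∸-comm M₂ x≤M₁)) (ℕP.+-∸-assoc (M₁ ∸ shift x) y≤M₂))

  coeffAt-+ : ∀ x y i → coeffAt (x +L y) i ≈ coeffAt x i + coeffAt y i
  coeffAt-+ x y i with indexView (shift x ℕ.⊔ shift y) i
  ... | within n i≡ eq rewrite coeffAt-coef (x +L y) i n eq | i≡ = refl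
  ... | below neg with neg (shift x ℕ.⊔ shift y) ℕP.≤-refl
                     | neg (shift x) (ℕP.m≤m⊔n (shift x) (shift y))
                     | neg (shift y) (ℕP.m≤n⊔m (shift x) (shift y))
  ...   | k , eq | kx , eqx | ky , eqy = trans (coeffAt-below (x +L y) i k eq)
          (sym (trans (+-cong (coeffAt-below x i kx eqx) (coeffAt-below y i ky eqy)) (+-identityˡ _)))

  -L_ : Laurent → Laurent
  -L x = laurent (shift x) (λ m → - coef x m)

  coeffAt-neg : ∀ x i → coeffAt (-L x) i ≈ - coeffAt x i
  coeffAt-neg x i rewrite coeffAt≡atℤ (-L x) i | coeffAt≡atℤ x i with i ℤ.+ + shift x
  ... | + m      = refl
  ... | -[1+ _ ] = sym -0#≈0#

  coeffAt-0L : ∀ i → coeffAt 0L i ≈ 0#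
  coeffAt-0L i rewrite coeffAt≡atℤ 0L i with i ℤ.+ + 0
  ... | + m      = refl
  ... | -[1+ _ ] = refl

  ≈L-refl : ∀ {x} → x ≈L x
  ≈L-refl i = refl

  ≈L-sym : ∀ {x y} → x ≈L y → y ≈L x
  ≈L-sym x≈y i = sym (x≈y i)

  ≈L-trans : ∀ {x y z} → x ≈L y → y ≈L z → x ≈L z
  ≈L-trans x≈y y≈z i = trans (x≈y i) (y≈z i)

  +L-cong : ∀ {x x′ y y′} → x ≈L x′ → y ≈L y′ → (x +L y) ≈L (x′ +L y′)
  +L-cong {x} {x′} {y} {y′} x≈x′ y≈y′ i =
    trans (coeffAt-+ x y i) (trans (+-cong (x≈x′ i) (y≈y′ i)) (sym (coeffAt-+ x′ y′ i)))

  +L-assoc : ∀ x y z → ((x +L y) +L z) ≈L (x +L (y +L z))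
  +L-assoc x y z i = trans (coeffAt-+ (x +L y) z i) (trans (+-congʳ (coeffAt-+ x y i))
    (trans (+-assoc _ _ _) (sym (trans (coeffAt-+ x (y +L z) i) (+-congˡ (coeffAt-+ y z i))))))

  +L-comm : ∀ x y → (x +L y) ≈L (y +L x)
  +L-comm x y i = trans (coeffAt-+ x y i) (trans (+-comm _ _) (sym (coeffAt-+ y x i)))

  +L-identityˡ : ∀ x → (0L +L x) ≈L x
  +L-identityˡ x i = trans (coeffAt-+ 0L x i) (trans (+-congʳ (coeffAt-0L i)) (+-identityˡ _))

  -L-inverseˡ : ∀ x → ((-L x) +L x) ≈L 0L
  -L-inverseˡ x i = trans (coeffAt-+ (-L x) x i)
    (trans (+-congʳ (coeffAt-neg x i)) (trans (-‿inverseˡ _) (sym (coeffAt-0L i))))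

  -L-cong : ∀ {x y} → x ≈L y → (-L x) ≈L (-L y)
  -L-cong {x} {y} x≈y i = trans (coeffAt-neg x i) (trans (-‿cong (x≈y i)) (sym (coeffAt-neg y i)))

  *L-cong : ∀ {x x′ y y′} → x ≈L x′ → y ≈L y′ → (x *L y) ≈L (x′ *L y′)
  *L-cong {x} {x′} {y} {y′} x≈x′ y≈y′ =
    ≈L-by-coefs (Mx ℕ.+ My) (x *L y) (x′ *L y′) (ℕP.+-mono-≤ x≤ y≤) (ℕP.+-mono-≤ x′≤ y′≤) λ n → begin
      coefs (Mx ℕ.+ My) (x *L y) n     ≈⟨ coefs-* Mx My x y x≤ y≤ n ⟩
      (coefs Mx x ⋆ coefs My y) n      ≈⟨ ⋆-cong _ _ _ _ (coefs-cong Mx x≈x′) (coefs-cong My y≈y′) n ⟩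
      (coefs Mx x′ ⋆ coefs My y′) n    ≈⟨ sym (coefs-* Mx My x′ y′ x′≤ y′≤ n) ⟩
      coefs (Mx ℕ.+ My) (x′ *L y′) n   ∎
    where
    Mx = shift x ℕ.⊔ shift x′
    My = shift y ℕ.⊔ shift y′
    x≤  = ℕP.m≤m⊔n (shift x) (shift x′)
    x′≤ = ℕP.m≤n⊔m (shift x) (shift x′)
    y≤  = ℕP.m≤m⊔n (shift y) (shift y′)
    y′≤ = ℕP.m≤n⊔m (shift y) (shift y′)

  *L-comm : ∀ x y → (x *L y) ≈L (y *L x)
  *L-comm x y = ≈L-by-coefs (Nx ℕ.+ Ny) (x *L y) (y *L x) ℕP.≤-refl (ℕP.≤-reflexive (ℕP.+-comm Ny Nx))
    λ n → begin
      coefs (Nx ℕ.+ Ny) (x *L y) n   ≈⟨ coefs-* Nx Ny x y ℕP.≤-refl ℕP.≤-refl n ⟩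
      (coefs Nx x ⋆ coefs Ny y) n    ≈⟨ ⋆-comm (coefs Nx x) (coefs Ny y) n ⟩
      (coefs Ny y ⋆ coefs Nx x) n    ≈⟨ sym (coefs-* Ny Nx y x ℕP.≤-refl ℕP.≤-refl n) ⟩
      coefs (Ny ℕ.+ Nx) (y *L x) n   ≡⟨ ≡.cong (λ M → coefs M (y *L x) n) (ℕP.+-comm Ny Nx) ⟩
      coefs (Nx ℕ.+ Ny) (y *L x) n   ∎
    where
    Nx = shift x
    Ny = shift y

  *L-assoc : ∀ x y z → ((x *L y) *L z) ≈L (x *L (y *L z))
  *L-assoc x y z =
    ≈L-by-coefs M ((x *L y) *L z) (x *L (y *L z)) ℕP.≤-refl (ℕP.≤-reflexive (≡.sym (ℕP.+-assoc Nx Ny Nz)))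
    λ n → begin
      coefs M ((x *L y) *L z) n
        ≈⟨ coefs-* (Nx ℕ.+ Ny) Nz (x *L y) z ℕP.≤-refl ℕP.≤-refl n ⟩
      (coefs (Nx ℕ.+ Ny) (x *L y) ⋆ coefs Nz z) n
        ≈⟨ ⋆-cong _ _ (coefs Nz z) (coefs Nz z) (coefs-* Nx Ny x y ℕP.≤-refl ℕP.≤-refl) (λ _ → refl) n ⟩
      ((coefs Nx x ⋆ coefs Ny y) ⋆ coefs Nz z) n
        ≈⟨ ⋆-assoc (coefs Nx x) (coefs Ny y) (coefs Nz z) n ⟩
      (coefs Nx x ⋆ (coefs Ny y ⋆ coefs Nz z)) n
        ≈⟨ sym (⋆-cong _ _ _ (coefs Ny y ⋆ coefs Nz z)
                 (λ _ → refl) (coefs-* Ny Nz y z ℕP.≤-refl ℕP.≤-refl) n) ⟩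
      (coefs Nx x ⋆ coefs (Ny ℕ.+ Nz) (y *L z)) n
        ≈⟨ sym (coefs-* Nx (Ny ℕ.+ Nz) x (y *L z) ℕP.≤-refl ℕP.≤-refl n) ⟩
      coefs (Nx ℕ.+ (Ny ℕ.+ Nz)) (x *L (y *L z)) n
        ≡⟨ ≡.cong (λ K → coefs K (x *L (y *L z)) n) (≡.sym (ℕP.+-assoc Nx Ny Nz)) ⟩
      coefs M (x *L (y *L z)) n ∎
    where
    Nx = shift x
    Ny = shift y
    Nz = shift z
    M  = (Nx ℕ.+ Ny) ℕ.+ Nz

  *L-distribˡ : ∀ x y z → (x *L (y +L z)) ≈L ((x *L y) +L (x *L z))
  *L-distribˡ x y z = ≈L-by-coefs M (x *L (y +L z)) ((x *L y) +L (x *L z)) ℕP.≤-refl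
    (ℕP.⊔-lub (ℕP.+-monoʳ-≤ Nx y≤) (ℕP.+-monoʳ-≤ Nx z≤))
    λ n → begin
      coefs M (x *L (y +L z)) n
        ≈⟨ coefs-* Nx K x (y +L z) ℕP.≤-refl ℕP.≤-refl n ⟩
      (coefs Nx x ⋆ coefs K (y +L z)) n
        ≈⟨ ⋆-cong _ _ _ (λ k → coefs K y k + coefs K z k) (λ _ → refl) (λ k → coeffAt-+ y z (+ k ℤ.- + K)) n ⟩
      (coefs Nx x ⋆ (λ k → coefs K y k + coefs K z k)) n
        ≈⟨ ⋆-distribˡ (coefs Nx x) (coefs K y) (coefs K z) n ⟩
      (coefs Nx x ⋆ coefs K y) n + (coefs Nx x ⋆ coefs K z) n
        ≈⟨ sym (+-cong (coefs-* Nx K x y ℕP.≤-refl y≤ n) (coefs-* Nx K x z ℕP.≤-refl z≤ n)) ⟩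
      coefs M (x *L y) n + coefs M (x *L z) n
        ≈⟨ sym (coeffAt-+ (x *L y) (x *L z) (+ n ℤ.- + M)) ⟩
      coefs M ((x *L y) +L (x *L z)) n ∎
    where
    Nx = shift x
    K  = shift y ℕ.⊔ shift z
    M  = Nx ℕ.+ K
    y≤ = ℕP.m≤m⊔n (shift y) (shift z)
    z≤ = ℕP.m≤n⊔m (shift y) (shift z)

  *L-identityˡ : ∀ x → (1L *L x) ≈L x
  *L-identityˡ x = ≈L-by-coefs (shift x) (1L *L x) x ℕP.≤-refl ℕP.≤-refl λ n →
    trans (coefs-* 0 (shift x) 1L x z≤n ℕP.≤-refl n)
      (trans (⋆-cong _ δ₀ _ (coefs (shift x) x) coefs-1L (λ _ → refl) n) (⋆-identityˡ (coefs (shift x) x) n))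
    where
    coefs-1L : ∀ k → coefs 0 1L k ≈ δ₀ k
    coefs-1L zero    = refl
    coefs-1L (suc k) = refl

  -- A wrapper record, so that x ≋ y does not unfold and ring lemmas can infer x and y.
  record _≋_ (x y : Laurent) : Set where
    constructor mk≋
    field un≋ : x ≈L y
  open _≋_ public

  laurentRing : CommutativeRing 0ℓ 0ℓ
  laurentRing = record
    { Carrier = Laurent ; _≈_ = _≋_ ; _+_ = _+L_ ; _*_ = _*L_ ; -_ = -L_ ; 0# = 0L ; 1# = 1L
    ; isCommutativeRing = record
      { isRing = record
        { +-isAbelianGroup = record
          { isGroup = record
            { isMonoid = record
              { isSemigroup = record
                { isMagma = record
                  { isEquivalence = record
                    { refl  = mk≋ ≈L-refl
                    ; sym   = λ x≈y → mk≋ (≈L-sym (un≋ x≈y))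
                    ; trans = λ x≈y y≈z → mk≋ (≈L-trans (un≋ x≈y) (un≋ y≈z)) }
                  ; ∙-cong = λ x≈y u≈v → mk≋ (+L-cong (un≋ x≈y) (un≋ u≈v)) }
                ; assoc = λ x y z → mk≋ (+L-assoc x y z) }
              ; identity = (λ x → mk≋ (+L-identityˡ x))
                         , (λ x → mk≋ (≈L-trans (+L-comm x 0L) (+L-identityˡ x))) }
            ; inverse = (λ x → mk≋ (-L-inverseˡ x))
                      , (λ x → mk≋ (≈L-trans (+L-comm x (-L x)) (-L-inverseˡ x)))
            ; ⁻¹-cong = λ x≈y → mk≋ (-L-cong (un≋ x≈y)) }
          ; comm = λ x y → mk≋ (+L-comm x y) }
        ; *-cong = λ x≈y u≈v → mk≋ (*L-cong (un≋ x≈y) (un≋ u≈v))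
        ; *-assoc = λ x y z → mk≋ (*L-assoc x y z)
        ; *-identity = (λ x → mk≋ (*L-identityˡ x))
                     , (λ x → mk≋ (≈L-trans (*L-comm x 1L) (*L-identityˡ x)))
        ; distrib = (λ x y z → mk≋ (*L-distribˡ x y z))
                  , (λ x y z → mk≋ (≈L-trans (*L-comm (y +L z) x)
                       (≈L-trans (*L-distribˡ x y z) (+L-cong (*L-comm x y) (*L-comm x z))))) }
      ; *-comm = λ x y → mk≋ (*L-comm x y) } }

i<i+1 : ∀ i → i ℤ.< i ℤ.+ + 1
i<i+1 i = ≡.subst (ℤ._< i ℤ.+ + 1) (ℤP.+-identityʳ i) (ℤP.+-monoʳ-< i (ℤ.+<+ (s≤s z≤n)))

i<j⇒i+1≤j : ∀ {i j} → i ℤ.< j → i ℤ.+ + 1 ℤ.≤ j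
i<j⇒i+1≤j {i} {j} i<j = ≡.subst (ℤ._≤ j) (ℤP.+-comm (+ 1) i) (ℤP.i<j⇒suc[i]≤j i<j)

+-cancelʳ-<ℤ : ∀ {i j} c → i ℤ.+ c ℤ.< j ℤ.+ c → i ℤ.< j
+-cancelʳ-<ℤ {i} {j} c lt = ≡.subst₂ ℤ._<_ (n+m-m≡n i c) (n+m-m≡n j c) (ℤP.+-monoˡ-< (ℤ.- c) lt)

+-cancelʳ-≤ℤ : ∀ {i j} c → i ℤ.+ c ℤ.≤ j ℤ.+ c → i ℤ.≤ j
+-cancelʳ-≤ℤ {i} {j} c le = ≡.subst₂ ℤ._≤_ (n+m-m≡n i c) (n+m-m≡n j c) (ℤP.+-monoˡ-≤ (ℤ.- c) le)

i≤0⇒i+j≤j : ∀ i j → i ℤ.≤ + 0 → i ℤ.+ j ℤ.≤ j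
i≤0⇒i+j≤j i j i≤0 = ≡.subst₂ ℤ._≤_ (ℤP.+-comm j i) (ℤP.+-identityʳ j) (ℤP.+-monoʳ-≤ j i≤0)

≤0⊎≥1 : ∀ i → (i ℤ.≤ + 0) ⊎ (+ 1 ℤ.≤ i)
≤0⊎≥1 (+ zero)  = inj₁ (ℤ.+≤+ z≤n)
≤0⊎≥1 (+ suc n) = inj₂ (ℤ.+≤+ (s≤s z≤n))
≤0⊎≥1 -[1+ n ]  = inj₁ ℤ.-≤+

-n≤0 : ∀ n → ℤ.- + n ℤ.≤ + 0
-n≤0 zero    = ℤ.+≤+ z≤n
-n≤0 (suc n) = ℤ.-≤+

≤0⇒≡-n : ∀ v → v ℤ.≤ + 0 → ∃ λ n → v ≡ ℤ.- + n
≤0⇒≡-n (+ zero)  _           = 0 , ≡.refl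
≤0⇒≡-n -[1+ n ]  _           = suc n , ≡.refl
≤0⇒≡-n (+ suc n) (ℤ.+≤+ ())

-‿-‿+ : ∀ n → ℤ.- (ℤ.- (+ n)) ≡ + n
-‿-‿+ zero    = ≡.refl
-‿-‿+ (suc n) = ≡.refl

i+[N+∣i∣]≥0 : ∀ (i : ℤ) N → ∃ λ p → i ℤ.+ + (N ℕ.+ ℤ.∣ i ∣) ≡ + p
i+[N+∣i∣]≥0 (+ a)    N = a ℕ.+ (N ℕ.+ a) , ≡.refl
i+[N+∣i∣]≥0 -[1+ a ] N = (N ℕ.+ suc a) ∸ suc a ,
  ≡.trans (ℤP.+-comm -[1+ a ] (+ (N ℕ.+ suc a)))
    (≡.trans (ℤP.m-n≡m⊖n (N ℕ.+ suc a) (suc a)) (ℤP.⊖-≥ (ℕP.m≤n+m (suc a) N)))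

module Valuation (F : FiniteField) where
  open FiniteField F hiding (zero)
  open LaurentSeries F
  open FiniteSums F
  open LaurentArithmetic F
  open import Algebra.Properties.Ring ring using (-0#≈0#; -‿involutive)
  open import Relation.Binary.Reasoning.Setoid setoid

  -- The valuation at infinity: ‖x‖ ≤ q^(−v) and ‖x‖ = q^(−v) respectively.
  ValAtLeast : Laurent → ℤ → Set
  ValAtLeast x v = ∀ i → i ℤ.< v → coeffAt x i ≈ 0#

  HasValuation : Laurent → ℤ → Set
  HasValuation x v = ¬ (coeffAt x v ≈ 0#) × ValAtLeast x v

  valAtLeast-cong : ∀ {x y v} → x ≈L y → ValAtLeast x v → ValAtLeast y v
  valAtLeast-cong x≈y x≥v i i<v = trans (sym (x≈y i)) (x≥v i i<v)

  hasValuation-cong : ∀ {x y v} → x ≈L y → HasValuation x v → HasValuation y v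
  hasValuation-cong {v = v} x≈y (x≉0 , x≥v) = (λ y≈0 → x≉0 (trans (x≈y v) y≈0)) , valAtLeast-cong x≈y x≥v

  valAtLeast-weaken : ∀ {x v w} → w ℤ.≤ v → ValAtLeast x v → ValAtLeast x w
  valAtLeast-weaken w≤v x≥v i i<w = x≥v i (ℤP.<-≤-trans i<w w≤v)

  valAtLeast-0L : ∀ v → ValAtLeast 0L v
  valAtLeast-0L v i _ = coeffAt-0L i

  valAtLeast-+ : ∀ {x y v} → ValAtLeast x v → ValAtLeast y v → ValAtLeast (x +L y) v
  valAtLeast-+ {x} {y} x≥v y≥v i i<v = trans (coeffAt-+ x y i) (trans (+-cong (x≥v i i<v) (y≥v i i<v)) (+-identityˡ _))

  valAtLeast-neg : ∀ {x v} → ValAtLeast x v → ValAtLeast (-L x) v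
  valAtLeast-neg {x} x≥v i i<v = trans (coeffAt-neg x i) (trans (-‿cong (x≥v i i<v)) -0#≈0#)

  hasValuation-+ : ∀ {x y v} → HasValuation x v → ValAtLeast y (v ℤ.+ + 1) → HasValuation (x +L y) v
  hasValuation-+ {x} {y} {v} (x≉0 , x≥v) y>v =
    (λ sum≈0 → x≉0 (trans (sym (trans (+-congˡ (y>v v (i<i+1 v))) (+-identityʳ _)))
                          (trans (sym (coeffAt-+ x y v)) sum≈0))) ,
    valAtLeast-+ x≥v (valAtLeast-weaken (ℤP.i≤i+j v (+ 1)) y>v)

  hasValuation-neg : ∀ {x v} → HasValuation x v → HasValuation (-L x) v
  hasValuation-neg {x} {v} (x≉0 , x≥v) =
    (λ -x≈0 → x≉0 (trans (sym (-‿involutive _)) (trans (-‿cong (trans (sym (coeffAt-neg x v)) -x≈0)) -0#≈0#))) ,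
    valAtLeast-neg x≥v

  hasValuation-1L : HasValuation 1L (+ 0)
  hasValuation-1L = 1≉0 , λ
    { -[1+ n ] _ → coeffAt-below 1L -[1+ n ] n (ℤP.+-identityʳ -[1+ n ])
    ; (+ n) (ℤ.+<+ ()) }

  hasValuation-unique : ∀ {x v w} → HasValuation x v → HasValuation x w → v ≡ w
  hasValuation-unique {x} {v} {w} (v≉0 , x≥v) (w≉0 , x≥w) with ℤP.<-cmp v w
  ... | tri< v<w _ _ = ⊥-elim (v≉0 (x≥w v v<w))
  ... | tri≈ _ v≡w _ = v≡w
  ... | tri> _ _ w<v = ⊥-elim (w≉0 (x≥v w w<v))

  hasValuation⇒≉0L : ∀ {x v} → HasValuation x v → ¬ (x ≈L 0L)
  hasValuation⇒≉0L {x} {v} (x≉0 , _) x≈0 = x≉0 (trans (x≈0 v) (coeffAt-0L v))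

  hasValuation⇒≤ : ∀ {x v} → HasValuation x v → ∀ i → ¬ (coeffAt x i ≈ 0#) → v ℤ.≤ i
  hasValuation⇒≤ {v = v} (_ , x≥v) i xi≉0 = ℤP.≮⇒≥ (λ i<v → xi≉0 (x≥v i i<v))

  *-≉0 : ∀ {a b} → ¬ (a ≈ 0#) → ¬ (b ≈ 0#) → ¬ ((a * b) ≈ 0#)
  *-≉0 {a} {b} a≉0 b≉0 ab≈0 with inverse a a≉0
  ... | a⁻¹ , aa⁻¹≈1 = b≉0 (begin
    b              ≈⟨ sym (*-identityˡ b) ⟩
    1# * b         ≈⟨ *-congʳ (sym aa⁻¹≈1) ⟩
    (a * a⁻¹) * b  ≈⟨ *-congʳ (*-comm a a⁻¹) ⟩
    (a⁻¹ * a) * b  ≈⟨ *-assoc a⁻¹ a b ⟩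
    a⁻¹ * (a * b)  ≈⟨ *-congˡ ab≈0 ⟩
    a⁻¹ * 0#       ≈⟨ zeroʳ a⁻¹ ⟩
    0#             ∎)

  coeffAt≡coefs : ∀ x v M p → + p ≡ v ℤ.+ + M → coeffAt x v ≡ coefs M x p
  coeffAt≡coefs x v M p p≡v+M =
    ≡.cong (coeffAt x) (≡.trans (≡.sym (n+m-m≡n v (+ M))) (≡.cong (ℤ._- + M) (≡.sym p≡v+M)))

  valAtLeast⇒coefs≈0 : ∀ x v M p → ValAtLeast x v → + p ≡ v ℤ.+ + M → ∀ k → k < p → coefs M x k ≈ 0#
  valAtLeast⇒coefs≈0 x v M p x≥v p≡v+M k k<p = x≥v (+ k ℤ.- + M)
    (+-cancelʳ-<ℤ (+ M) (≡.subst₂ ℤ._<_ (≡.sym (n-m+m≡n (+ k) (+ M))) p≡v+M (ℤ.+<+ k<p)))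

  coefs≈0⇒valAtLeast : ∀ x v M p → shift x ≤ M → + p ≡ v ℤ.+ + M → (∀ k → k < p → coefs M x k ≈ 0#) →
                       ValAtLeast x v
  coefs≈0⇒valAtLeast x v M p x≤M p≡v+M coefs≈0 i i<v with indexView M i
  ... | within n i≡ _ rewrite i≡ = coefs≈0 n
    (ℤP.drop‿+<+ (≡.subst₂ ℤ._<_ (n-m+m≡n (+ n) (+ M)) (≡.sym p≡v+M) (ℤP.+-monoˡ-< (+ M) i<v)))
  ... | below neg with neg (shift x) x≤M
  ...   | k , eq = coeffAt-below x i k eq

  alignedShift : Laurent → ℤ → ℕ
  alignedShift x v = shift x ℕ.+ ℤ.∣ v ∣

  alignedIndex : Laurent → ℤ → ℕ
  alignedIndex x v = proj₁ (i+[N+∣i∣]≥0 v (shift x))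

  alignedIndex≡ : ∀ x v → + alignedIndex x v ≡ v ℤ.+ + alignedShift x v
  alignedIndex≡ x v = ≡.sym (proj₂ (i+[N+∣i∣]≥0 v (shift x)))

  shift≤alignedShift : ∀ x v → shift x ≤ alignedShift x v
  shift≤alignedShift x v = ℕP.m≤m+n (shift x) ℤ.∣ v ∣

  alignedIndex-+ : ∀ x y v w →
    + (alignedIndex x v ℕ.+ alignedIndex y w) ≡ (v ℤ.+ w) ℤ.+ + (alignedShift x v ℕ.+ alignedShift y w)
  alignedIndex-+ x y v w = ≡.trans (≡.cong₂ ℤ._+_ (alignedIndex≡ x v) (alignedIndex≡ y w))
                                   (swap v w (+ alignedShift x v) (+ alignedShift y w))
    where
    swap : ∀ (v w a b : ℤ) → (v ℤ.+ a) ℤ.+ (w ℤ.+ b) ≡ (v ℤ.+ w) ℤ.+ (a ℤ.+ b)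
    swap = solve-∀

  valAtLeast⇒aligned≈0 : ∀ x v → ValAtLeast x v → ∀ k → k < alignedIndex x v → coefs (alignedShift x v) x k ≈ 0#
  valAtLeast⇒aligned≈0 x v x≥v = valAtLeast⇒coefs≈0 x v (alignedShift x v) (alignedIndex x v) x≥v (alignedIndex≡ x v)

  valAtLeast-* : ∀ {x y v w} → ValAtLeast x v → ValAtLeast y w → ValAtLeast (x *L y) (v ℤ.+ w)
  valAtLeast-* {x} {y} {v} {w} x≥v y≥w =
    coefs≈0⇒valAtLeast (x *L y) (v ℤ.+ w) (Mx ℕ.+ My) (px ℕ.+ py)
      (ℕP.+-mono-≤ (shift≤alignedShift x v) (shift≤alignedShift y w)) (alignedIndex-+ x y v w)
      λ k k<p → trans (coefs-* Mx My x y (shift≤alignedShift x v) (shift≤alignedShift y w) k)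
        (⋆-vanishes-below (coefs Mx x) (coefs My y) px py
          (valAtLeast⇒aligned≈0 x v x≥v) (valAtLeast⇒aligned≈0 y w y≥w) k k<p)
    where
    Mx My px py : ℕ
    Mx = alignedShift x v
    My = alignedShift y w
    px = alignedIndex x v
    py = alignedIndex y w

  hasValuation-* : ∀ {x y v w} → HasValuation x v → HasValuation y w → HasValuation (x *L y) (v ℤ.+ w)
  hasValuation-* {x} {y} {v} {w} (x≉0 , x≥v) (y≉0 , y≥w) = lead≉0 , valAtLeast-* x≥v y≥w
    where
    Mx My px py : ℕ
    Mx = alignedShift x v
    My = alignedShift y w
    px = alignedIndex x v
    py = alignedIndex y w
    lead≉0 : ¬ (coeffAt (x *L y) (v ℤ.+ w) ≈ 0#)
    lead≉0 xy≈0 = *-≉0 x≉0 y≉0 (begin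
      coeffAt x v * coeffAt y w
        ≡⟨ ≡.cong₂ _*_ (coeffAt≡coefs x v Mx px (alignedIndex≡ x v))
                       (coeffAt≡coefs y w My py (alignedIndex≡ y w)) ⟩
      coefs Mx x px * coefs My y py
        ≈⟨ sym (⋆-leading (coefs Mx x) (coefs My y) px py
                 (valAtLeast⇒aligned≈0 x v x≥v) (valAtLeast⇒aligned≈0 y w y≥w)) ⟩
      (coefs Mx x ⋆ coefs My y) (px ℕ.+ py)
        ≈⟨ sym (coefs-* Mx My x y (shift≤alignedShift x v) (shift≤alignedShift y w) (px ℕ.+ py)) ⟩
      coefs (Mx ℕ.+ My) (x *L y) (px ℕ.+ py)
        ≡⟨ ≡.sym (coeffAt≡coefs (x *L y) (v ℤ.+ w) (Mx ℕ.+ My) (px ℕ.+ py) (alignedIndex-+ x y v w)) ⟩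
      coeffAt (x *L y) (v ℤ.+ w)
        ≈⟨ xy≈0 ⟩
      0# ∎)

  first-nonzero : ∀ (f : ℕ → Carrier) m →
    (∀ k → k < m → f k ≈ 0#) ⊎ (∃ λ p → p < m × ¬ (f p ≈ 0#) × (∀ k → k < p → f k ≈ 0#))
  first-nonzero f zero = inj₁ (λ k ())
  first-nonzero f (suc m) with first-nonzero f m
  ... | inj₂ (p , p<m , fp≉0 , f<p≈0) = inj₂ (p , ℕP.m≤n⇒m≤1+n p<m , fp≉0 , f<p≈0)
  ... | inj₁ f<m≈0 with f m ≟ 0#
  ...   | no  fm≉0 = inj₂ (m , ℕP.≤-refl , fm≉0 , f<m≈0)
  ...   | yes fm≈0 = inj₁ f≤m≈0
    where
    f≤m≈0 : ∀ k → k < suc m → f k ≈ 0#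
    f≤m≈0 k k<1+m with ℕP.m≤n⇒m<n∨m≡n (ℕP.≤-pred k<1+m)
    ... | inj₁ k<m    = f<m≈0 k k<m
    ... | inj₂ ≡.refl = fm≈0

  first-nonzero⇒hasValuation : ∀ x p → ¬ (coefs (shift x) x p ≈ 0#) →
    (∀ k → k < p → coefs (shift x) x k ≈ 0#) → HasValuation x (+ p ℤ.- + shift x)
  first-nonzero⇒hasValuation x p xp≉0 x<p≈0 = xp≉0 ,
    coefs≈0⇒valAtLeast x (+ p ℤ.- + shift x) (shift x) p ℕP.≤-refl (≡.sym (n-m+m≡n (+ p) (+ shift x))) x<p≈0

  hasValuation-exists : ∀ x → NonZeroL x → ∃ (HasValuation x)
  hasValuation-exists x (i , xi≉0) with indexView (shift x) i
  ... | below neg = ⊥-elim (xi≉0 (coeffAt-below x i _ (proj₂ (neg (shift x) ℕP.≤-refl))))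
  ... | within n i≡ _ with first-nonzero (coefs (shift x) x) (suc n)
  ...   | inj₁ x≤n≈0 = ⊥-elim (xi≉0 (≡.subst (λ j → coeffAt x j ≈ 0#) (≡.sym i≡) (x≤n≈0 n ℕP.≤-refl)))
  ...   | inj₂ (p , _ , xp≉0 , x<p≈0) = _ , first-nonzero⇒hasValuation x p xp≉0 x<p≈0

  *L-≉0⇒≉0ʳ : ∀ x y i → ¬ (coeffAt (x *L y) i ≈ 0#) → NonZeroL y
  *L-≉0⇒≉0ʳ x y i xy≉0 with indexView (shift x ℕ.+ shift y) i
  ... | below neg = ⊥-elim (xy≉0 (coeffAt-below (x *L y) i _ (proj₂ (neg (shift x ℕ.+ shift y) ℕP.≤-refl))))
  ... | within m i≡ _ with sumTo-≉0 m (λ k → coefs (shift x) x k * coefs (shift y) y (m ∸ k))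
        (λ sum≈0 → xy≉0 (≡.subst (λ j → coeffAt (x *L y) j ≈ 0#) (≡.sym i≡)
          (trans (coefs-* (shift x) (shift y) x y ℕP.≤-refl ℕP.≤-refl m) sum≈0)))
  ...   | k , _ , term≉0 with coefs (shift y) y (m ∸ k) ≟ 0#
  ...     | yes y≈0 = ⊥-elim (term≉0 (trans (*-congˡ y≈0) (zeroʳ _)))
  ...     | no  y≉0 = + (m ∸ k) ℤ.- + shift y , y≉0

  *L-≉0⇒≉0ˡ : ∀ x y i → ¬ (coeffAt (x *L y) i ≈ 0#) → NonZeroL x
  *L-≉0⇒≉0ˡ x y i xy≉0 = *L-≉0⇒≉0ʳ y x i (λ yx≈0 → xy≉0 (trans (*L-comm x y i) yx≈0))

module Polynomials (F : FiniteField) where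
  open FiniteField F hiding (zero)
  open LaurentSeries F
  open FiniteSums F
  open LaurentArithmetic F
  open Valuation F
  open import Algebra.Properties.Ring ring using (-0#≈0#)

  IsPolynomial : Laurent → Set
  IsPolynomial x = ∀ i → + 1 ℤ.≤ i → coeffAt x i ≈ 0#

  IsPoly⇒IsPolynomial : ∀ {x} → IsPoly x → IsPolynomial x
  IsPoly⇒IsPolynomial poly (+ suc n) _ = poly n
  IsPoly⇒IsPolynomial poly (+ zero) (ℤ.+≤+ ())

  IsPolynomial⇒IsPoly : ∀ {x} → IsPolynomial x → IsPoly x
  IsPolynomial⇒IsPoly poly n = poly (+ suc n) (ℤ.+≤+ (s≤s z≤n))

  polynomial-0L : IsPolynomial 0L
  polynomial-0L i _ = coeffAt-0L i

  polynomial-1L : IsPolynomial 1L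
  polynomial-1L (+ suc zero)    _ = refl
  polynomial-1L (+ suc (suc n)) _ = refl
  polynomial-1L (+ zero) (ℤ.+≤+ ())

  polynomial-+ : ∀ x y → IsPolynomial x → IsPolynomial y → IsPolynomial (x +L y)
  polynomial-+ x y px py i 1≤i = trans (coeffAt-+ x y i) (trans (+-cong (px i 1≤i) (py i 1≤i)) (+-identityˡ _))

  polynomial-neg : ∀ x → IsPolynomial x → IsPolynomial (-L x)
  polynomial-neg x px i 1≤i = trans (coeffAt-neg x i) (trans (-‿cong (px i 1≤i)) -0#≈0#)

  private
    1≤i⇒N<m : ∀ i N m → + 1 ℤ.≤ i → i ℤ.+ + N ≡ + m → N < m
    1≤i⇒N<m i N m 1≤i eq = ℤP.drop‿+≤+ (≡.subst (ℤ._≤_ (+ suc N)) eq (ℤP.+-monoˡ-≤ (+ N) 1≤i))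

    i≤0⇒m≤N : ∀ i N m → i ℤ.≤ + 0 → i ℤ.+ + N ≡ + m → m ≤ N
    i≤0⇒m≤N i N m i≤0 eq = ℤP.drop‿+≤+ (≡.subst (ℤ._≤ + N) eq (ℤP.+-monoˡ-≤ (+ N) i≤0))

    coefs-polynomial : ∀ x → IsPolynomial x → ∀ k → shift x < k → coefs (shift x) x k ≈ 0#
    coefs-polynomial x px k N<k = px (+ k ℤ.- + shift x)
      (+-cancelʳ-≤ℤ (+ shift x)
        (≡.subst (ℤ._≤_ (+ 1 ℤ.+ + shift x)) (≡.sym (n-m+m≡n (+ k) (+ shift x))) (ℤ.+≤+ N<k)))

  polynomial-* : ∀ x y → IsPolynomial x → IsPolynomial y → IsPolynomial (x *L y)
  polynomial-* x y px py i 1≤i with indexView (shift x ℕ.+ shift y) i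
  ... | within m i≡ _ rewrite i≡ = trans (coefs-* (shift x) (shift y) x y ℕP.≤-refl ℕP.≤-refl m)
          (⋆-vanishes-above (coefs (shift x) x) (coefs (shift y) y) (shift x) (shift y)
            (coefs-polynomial x px) (coefs-polynomial y py) m
            (1≤i⇒N<m _ (shift x ℕ.+ shift y) m 1≤i (n-m+m≡n (+ m) (+ (shift x ℕ.+ shift y)))))
  ... | below neg = coeffAt-below (x *L y) i _ (proj₂ (neg (shift (x *L y)) ℕP.≤-refl))

  polynomial-valuation≤0 : ∀ {x v} → HasValuation x v → IsPolynomial x → v ℤ.≤ + 0
  polynomial-valuation≤0 {x} {v} (xv≉0 , _) px with ≤0⊎≥1 v
  ... | inj₁ v≤0 = v≤0
  ... | inj₂ 1≤v = ⊥-elim (xv≉0 (px v 1≤v))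

  polynomial-≈0L⊎valuation : ∀ x → IsPolynomial x → (x ≈L 0L) ⊎ ∃ (HasValuation x)
  polynomial-≈0L⊎valuation x px with first-nonzero (coefs (shift x) x) (suc (shift x))
  ... | inj₂ (p , _ , xp≉0 , x<p≈0) = inj₂ (_ , first-nonzero⇒hasValuation x p xp≉0 x<p≈0)
  ... | inj₁ x≤N≈0 = inj₁ λ i → trans (x≈0 i) (sym (coeffAt-0L i))
    where
    x≈0 : ∀ i → coeffAt x i ≈ 0#
    x≈0 i with ≤0⊎≥1 i
    ... | inj₂ 1≤i = px i 1≤i
    ... | inj₁ i≤0 with indexView (shift x) i
    ...   | within m i≡ _ rewrite i≡ =
            x≤N≈0 m (s≤s (i≤0⇒m≤N (+ m ℤ.- + shift x) (shift x) m i≤0 (n-m+m≡n (+ m) (+ shift x))))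
    ...   | below neg = coeffAt-below x i _ (proj₂ (neg (shift x) ℕP.≤-refl))

  private
    if-true : ∀ {b : Bool} {a c : Carrier} → T b → (if b then a else c) ≡ a
    if-true {true} _ = ≡.refl

    if-false : ∀ {b : Bool} {a c : Carrier} → ¬ T b → (if b then a else c) ≡ c
    if-false {false} _  = ≡.refl
    if-false {true}  ¬t = ⊥-elim (¬t tt)

  frac-coeff-pos : ∀ x i → + 1 ℤ.≤ i → coeffAt (frac x) i ≈ coeffAt x i
  frac-coeff-pos x i 1≤i rewrite coeffAt≡atℤ (frac x) i | coeffAt≡atℤ x i with i ℤ.+ + shift x in eq
  ... | + m      = reflexive (if-true (ℕP.<⇒<ᵇ (1≤i⇒N<m i (shift x) m 1≤i eq)))
  ... | -[1+ _ ] = refl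

  frac-coeff-nonpos : ∀ x i → i ℤ.≤ + 0 → coeffAt (frac x) i ≈ 0#
  frac-coeff-nonpos x i i≤0 rewrite coeffAt≡atℤ (frac x) i with i ℤ.+ + shift x in eq
  ... | + m      = reflexive (if-false (λ t → ℕP.<⇒≱ (ℕP.<ᵇ⇒< (shift x) m t) (i≤0⇒m≤N i (shift x) m i≤0 eq)))
  ... | -[1+ _ ] = refl

  intPart-coeff-pos : ∀ x i → + 1 ℤ.≤ i → coeffAt (intPart x) i ≈ 0#
  intPart-coeff-pos x i 1≤i rewrite coeffAt≡atℤ (intPart x) i with i ℤ.+ + shift x in eq
  ... | + m      =
    reflexive (if-false (λ t → ℕP.<⇒≱ (1≤i⇒N<m i (shift x) m 1≤i eq) (ℕP.≤ᵇ⇒≤ m (shift x) t)))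
  ... | -[1+ _ ] = refl

  intPart-coeff-nonpos : ∀ x i → i ℤ.≤ + 0 → coeffAt (intPart x) i ≈ coeffAt x i
  intPart-coeff-nonpos x i i≤0 rewrite coeffAt≡atℤ (intPart x) i | coeffAt≡atℤ x i with i ℤ.+ + shift x in eq
  ... | + m      = reflexive (if-true (ℕP.≤⇒≤ᵇ (i≤0⇒m≤N i (shift x) m i≤0 eq)))
  ... | -[1+ _ ] = refl

  intPart-polynomial : ∀ x → IsPolynomial (intPart x)
  intPart-polynomial = intPart-coeff-pos

  intPart+frac : ∀ x → x ≈L (intPart x +L frac x)
  intPart+frac x i with ≤0⊎≥1 i
  ... | inj₁ i≤0 = sym (trans (coeffAt-+ _ _ i)
    (trans (+-cong (intPart-coeff-nonpos x i i≤0) (frac-coeff-nonpos x i i≤0)) (+-identityʳ _)))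
  ... | inj₂ 1≤i = sym (trans (coeffAt-+ _ _ i)
    (trans (+-cong (intPart-coeff-pos x i 1≤i) (frac-coeff-pos x i 1≤i)) (+-identityˡ _)))

  frac-unique : ∀ x P E → x ≈L (P +L E) → IsPolynomial P → ValAtLeast E (+ 1) → frac x ≈L E
  frac-unique x P E x≈P+E pP E≥1 i with ≤0⊎≥1 i
  ... | inj₁ i≤0 = trans (frac-coeff-nonpos x i i≤0) (sym (E≥1 i (ℤP.≤-<-trans i≤0 (ℤ.+<+ (s≤s z≤n)))))
  ... | inj₂ 1≤i = trans (frac-coeff-pos x i 1≤i)
    (trans (x≈P+E i) (trans (coeffAt-+ P E i) (trans (+-congʳ (pP i 1≤i)) (+-identityˡ _))))

module ContinuantIdentities {c ℓ} (R : CommutativeRing c ℓ) where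
  open CommutativeRing R
  open import Algebra.Properties.Ring ring using (+-cancelˡ)
  open import Algebra.Solver.Ring.NaturalCoefficients.Default commutativeSemiring
  open import Relation.Binary.Reasoning.Setoid setoid

  +≈⇒≈-+ : ∀ x y z → x + y ≈ z → x ≈ - y + z
  +≈⇒≈-+ x y z x+y≈z = +-cancelˡ y x (- y + z) (begin
    y + x          ≈⟨ +-comm y x ⟩
    x + y          ≈⟨ x+y≈z ⟩
    z              ≈⟨ sym (+-identityˡ z) ⟩
    0# + z         ≈⟨ +-congʳ (sym (-‿inverseʳ y)) ⟩
    (y + - y) + z  ≈⟨ +-assoc _ _ _ ⟩
    y + (- y + z)  ∎)

  x+0≈z : ∀ x y z → x + y ≈ z → y ≈ 0# → x ≈ z
  x+0≈z x y z x+y≈z y≈0 = trans (sym (trans (+-congˡ y≈0) (+-identityʳ x))) x+y≈z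

  0*≈0 : ∀ x y → x ≈ 0# → x * y ≈ 0#
  0*≈0 x y x≈0 = trans (*-congʳ x≈0) (zeroˡ y)

  approximation-step : ∀ A Q Q′ a P P′ E E′ → Q * a ≈ P + E → Q′ * a ≈ P′ + E′ →
                       (A * Q + Q′) * a ≈ (A * P + P′) + (A * E + E′)
  approximation-step A Q Q′ a P P′ E E′ QE Q′E′ = begin
    (A * Q + Q′) * a         ≈⟨ expand A Q Q′ a ⟩
    A * (Q * a) + Q′ * a     ≈⟨ +-cong (*-congˡ QE) Q′E′ ⟩
    A * (P + E) + (P′ + E′)  ≈⟨ regroup A P E P′ E′ ⟩
    (A * P + P′) + (A * E + E′) ∎
    where
    expand : ∀ A Q Q′ a → (A * Q + Q′) * a ≈ A * (Q * a) + Q′ * a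
    expand = solve 4 (λ A Q Q′ a → (A :* Q :+ Q′) :* a := A :* (Q :* a) :+ Q′ :* a) refl
    regroup : ∀ A P E P′ E′ → A * (P + E) + (P′ + E′) ≈ (A * P + P′) + (A * E + E′)
    regroup = solve 5 (λ A P E P′ E′ → A :* (P :+ E) :+ (P′ :+ E′) := (A :* P :+ P′) :+ (A :* E :+ E′)) refl

  -- With a = A + b′ the next complete quotient and a b = 1, the relation E + b E′ = 0
  -- between consecutive errors propagates.
  error-step : ∀ A b′ a b E E′ → E + b * E′ ≈ 0# → a * b ≈ 1# → a ≈ A + b′ →
               (A * E + E′) + b′ * E ≈ 0#
  error-step A b′ a b E E′ E+bE′≈0 ab≈1 a≈A+b′ = begin
    (A * E + E′) + b′ * E ≈⟨ regroup A E E′ b′ ⟩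
    (A + b′) * E + E′     ≈⟨ +-congʳ (*-congʳ (sym a≈A+b′)) ⟩
    a * E + E′            ≈⟨ +-congˡ (sym (trans (*-congˡ ab≈1) (*-identityʳ E′))) ⟩
    a * E + E′ * (a * b)  ≈⟨ factor a E E′ b ⟩
    a * (E + b * E′)      ≈⟨ *-congˡ E+bE′≈0 ⟩
    a * 0#                ≈⟨ zeroʳ a ⟩
    0#                    ∎
    where
    regroup : ∀ A E E′ b′ → (A * E + E′) + b′ * E ≈ (A + b′) * E + E′
    regroup = solve 4 (λ A E E′ b′ → (A :* E :+ E′) :+ b′ :* E := (A :+ b′) :* E :+ E′) refl
    factor : ∀ a E E′ b → a * E + E′ * (a * b) ≈ a * (E + b * E′)
    factor = solve 4 (λ a E E′ b → a :* E :+ E′ :* (a :* b) := a :* (E :+ b :* E′)) refl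

  determinant-step : ∀ A a b c d → a * d ≈ b * c + 1# → d * (A * c + a) ≈ c * (A * d + b) + 1#
  determinant-step A a b c d ad≈bc+1 = begin
    d * (A * c + a)             ≈⟨ expand A a c d ⟩
    A * (c * d) + a * d         ≈⟨ +-congˡ ad≈bc+1 ⟩
    A * (c * d) + (b * c + 1#)  ≈⟨ regroup A b c d 1# ⟩
    c * (A * d + b) + 1#        ∎
    where
    expand : ∀ A a c d → d * (A * c + a) ≈ A * (c * d) + a * d
    expand = solve 4 (λ A a c d → d :* (A :* c :+ a) := A :* (c :* d) :+ a :* d) refl
    regroup : ∀ A b c d o → A * (c * d) + (b * c + o) ≈ c * (A * d + b) + o
    regroup = solve 5 (λ A b c d o → A :* (c :* d) :+ (b :* c :+ o) := c :* (A :* d :+ b) :+ o) refl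

  -- Solving (Q, P) = u (Q₀, P₀) + v (Q₁, P₁) by Cramer's rule, for the determinant Q₀ P₁ − P₀ Q₁ = 1.
  unimodular-solve : ∀ Q P nQ nP Q₀ P₀ Q₁ P₁ → Q + nQ ≈ 0# → P + nP ≈ 0# → Q₀ * P₁ ≈ P₀ * Q₁ + 1# →
    ((Q * P₁ + nP * Q₁) * Q₀ + (P * Q₀ + nQ * P₀) * Q₁ ≈ Q) ×
    ((Q * P₁ + nP * Q₁) * P₀ + (P * Q₀ + nQ * P₀) * P₁ ≈ P)
  unimodular-solve Q P nQ nP Q₀ P₀ Q₁ P₁ Q+nQ≈0 P+nP≈0 det≈1 = solveQ , solveP
    where
    solveQ : (Q * P₁ + nP * Q₁) * Q₀ + (P * Q₀ + nQ * P₀) * Q₁ ≈ Q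
    solveQ = begin
      (Q * P₁ + nP * Q₁) * Q₀ + (P * Q₀ + nQ * P₀) * Q₁
        ≈⟨ expand Q P nQ nP Q₀ P₀ Q₁ P₁ ⟩
      Q * (Q₀ * P₁) + ((nP + P) * (Q₀ * Q₁) + nQ * (P₀ * Q₁))
        ≈⟨ +-congʳ (*-congˡ det≈1) ⟩
      Q * (P₀ * Q₁ + 1#) + ((nP + P) * (Q₀ * Q₁) + nQ * (P₀ * Q₁))
        ≈⟨ regroup Q nQ nP P Q₀ Q₁ (P₀ * Q₁) 1# ⟩
      Q * 1# + ((Q + nQ) * (P₀ * Q₁) + (nP + P) * (Q₀ * Q₁))
        ≈⟨ +-cong (*-identityʳ Q) (+-cong (0*≈0 _ _ Q+nQ≈0) (0*≈0 _ _ (trans (+-comm nP P) P+nP≈0))) ⟩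
      Q + (0# + 0#)
        ≈⟨ trans (+-congˡ (+-identityˡ 0#)) (+-identityʳ Q) ⟩
      Q ∎
      where
      expand : ∀ Q P nQ nP Q₀ P₀ Q₁ P₁ → (Q * P₁ + nP * Q₁) * Q₀ + (P * Q₀ + nQ * P₀) * Q₁
               ≈ Q * (Q₀ * P₁) + ((nP + P) * (Q₀ * Q₁) + nQ * (P₀ * Q₁))
      expand = solve 8 (λ Q P nQ nP Q₀ P₀ Q₁ P₁ → (Q :* P₁ :+ nP :* Q₁) :* Q₀ :+ (P :* Q₀ :+ nQ :* P₀) :* Q₁
                         := Q :* (Q₀ :* P₁) :+ ((nP :+ P) :* (Q₀ :* Q₁) :+ nQ :* (P₀ :* Q₁))) refl
      regroup : ∀ Q nQ nP P Q₀ Q₁ T o → Q * (T + o) + ((nP + P) * (Q₀ * Q₁) + nQ * T)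
                ≈ Q * o + ((Q + nQ) * T + (nP + P) * (Q₀ * Q₁))
      regroup = solve 8 (λ Q nQ nP P Q₀ Q₁ T o → Q :* (T :+ o) :+ ((nP :+ P) :* (Q₀ :* Q₁) :+ nQ :* T)
                          := Q :* o :+ ((Q :+ nQ) :* T :+ (nP :+ P) :* (Q₀ :* Q₁))) refl
    solveP : (Q * P₁ + nP * Q₁) * P₀ + (P * Q₀ + nQ * P₀) * P₁ ≈ P
    solveP = begin
      (Q * P₁ + nP * Q₁) * P₀ + (P * Q₀ + nQ * P₀) * P₁
        ≈⟨ expand Q P nQ nP Q₀ P₀ Q₁ P₁ ⟩
      P * (Q₀ * P₁) + ((Q + nQ) * (P₀ * P₁) + nP * (P₀ * Q₁))
        ≈⟨ +-congʳ (*-congˡ det≈1) ⟩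
      P * (P₀ * Q₁ + 1#) + ((Q + nQ) * (P₀ * P₁) + nP * (P₀ * Q₁))
        ≈⟨ regroup P nP (P₀ * Q₁) 1# ((Q + nQ) * (P₀ * P₁)) ⟩
      P * 1# + ((P + nP) * (P₀ * Q₁) + (Q + nQ) * (P₀ * P₁))
        ≈⟨ +-cong (*-identityʳ P) (+-cong (0*≈0 _ _ P+nP≈0) (0*≈0 _ _ Q+nQ≈0)) ⟩
      P + (0# + 0#)
        ≈⟨ trans (+-congˡ (+-identityˡ 0#)) (+-identityʳ P) ⟩
      P ∎
      where
      expand : ∀ Q P nQ nP Q₀ P₀ Q₁ P₁ → (Q * P₁ + nP * Q₁) * P₀ + (P * Q₀ + nQ * P₀) * P₁
               ≈ P * (Q₀ * P₁) + ((Q + nQ) * (P₀ * P₁) + nP * (P₀ * Q₁))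
      expand = solve 8 (λ Q P nQ nP Q₀ P₀ Q₁ P₁ → (Q :* P₁ :+ nP :* Q₁) :* P₀ :+ (P :* Q₀ :+ nQ :* P₀) :* P₁
                         := P :* (Q₀ :* P₁) :+ ((Q :+ nQ) :* (P₀ :* P₁) :+ nP :* (P₀ :* Q₁))) refl
      regroup : ∀ P nP T o X → P * (T + o) + (X + nP * T) ≈ P * o + ((P + nP) * T + X)
      regroup = solve 5 (λ P nP T o X → P :* (T :+ o) :+ (X :+ nP :* T) := P :* o :+ ((P :+ nP) :* T :+ X)) refl

  combination-error : ∀ u v Q₀ P₀ E₀ Q₁ P₁ E₁ Q P E a →
    Q₀ * a ≈ P₀ + E₀ → Q₁ * a ≈ P₁ + E₁ → Q * a ≈ P + E →
    u * Q₀ + v * Q₁ ≈ Q → u * P₀ + v * P₁ ≈ P → u * E₀ + v * E₁ ≈ E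
  combination-error u v Q₀ P₀ E₀ Q₁ P₁ E₁ Q P E a QE₀ QE₁ QE Q≈ P≈ = +-cancelˡ P _ _ (begin
    P + (u * E₀ + v * E₁)                  ≈⟨ +-congʳ (sym P≈) ⟩
    (u * P₀ + v * P₁) + (u * E₀ + v * E₁)  ≈⟨ regroup u v P₀ E₀ P₁ E₁ ⟩
    u * (P₀ + E₀) + v * (P₁ + E₁)          ≈⟨ sym (+-cong (*-congˡ QE₀) (*-congˡ QE₁)) ⟩
    u * (Q₀ * a) + v * (Q₁ * a)            ≈⟨ factor u v Q₀ Q₁ a ⟩
    (u * Q₀ + v * Q₁) * a                  ≈⟨ *-congʳ Q≈ ⟩
    Q * a                                  ≈⟨ QE ⟩
    P + E                                  ∎)
    where
    regroup : ∀ u v P₀ E₀ P₁ E₁ →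
              (u * P₀ + v * P₁) + (u * E₀ + v * E₁) ≈ u * (P₀ + E₀) + v * (P₁ + E₁)
    regroup = solve 6 (λ u v P₀ E₀ P₁ E₁ → (u :* P₀ :+ v :* P₁) :+ (u :* E₀ :+ v :* E₁)
                        := u :* (P₀ :+ E₀) :+ v :* (P₁ :+ E₁)) refl
    factor : ∀ u v Q₀ Q₁ a → u * (Q₀ * a) + v * (Q₁ * a) ≈ (u * Q₀ + v * Q₁) * a
    factor = solve 5 (λ u v Q₀ Q₁ a → u :* (Q₀ :* a) :+ v :* (Q₁ :* a) := (u :* Q₀ :+ v :* Q₁) :* a) refl

module ContinuedFractions (F : FiniteField) where
  open FiniteField F hiding (zero)
  open LaurentSeries F
  open LaurentArithmetic F
  open Valuation F
  open Polynomials F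
  open ContinuantIdentities laurentRing
  module 𝕃 = CommutativeRing laurentRing
  open import Algebra.Properties.Ring 𝕃.ring using (+-inverseˡ-unique; -‿distribʳ-*)

  private
    dominant-term : ∀ u E₀ y e₀ → IsPolynomial u → ¬ (u ≈L 0L) → HasValuation E₀ e₀ →
                    (∀ a → HasValuation u a → ValAtLeast y ((a ℤ.+ e₀) ℤ.+ + 1)) →
                    ∃ λ t → HasValuation ((u *L E₀) +L y) t × t ℤ.≤ e₀
    dominant-term u E₀ y e₀ pu u≉0 E₀∼e₀ y-small with polynomial-≈0L⊎valuation u pu
    ... | inj₁ u≈0       = ⊥-elim (u≉0 u≈0)
    ... | inj₂ (a , u∼a) = a ℤ.+ e₀ , hasValuation-+ (hasValuation-* u∼a E₀∼e₀) (y-small a u∼a) ,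
                           i≤0⇒i+j≤j a e₀ (polynomial-valuation≤0 u∼a pu)

  -- For deg Q₀ < deg Q₁, deg Q < deg Q₁ and ‖E₁‖ ≤ ‖E₀‖ write Q = u Q₀ + v Q₁: either v = 0, or
  -- u Q₀ = Q − v Q₁ has the degree of v Q₁; either way u E₀ is the dominant term of u E₀ + v E₁.
  combination-valuation : ∀ (u v Q₀ Q₁ E₀ E₁ Q : Laurent) (a₀ a₁ e₀ e₁ w : ℤ) →
    IsPolynomial u → IsPolynomial v →
    HasValuation Q₀ a₀ → HasValuation Q₁ a₁ → HasValuation E₀ e₀ → HasValuation E₁ e₁ → HasValuation Q w →
    a₁ ℤ.< a₀ → e₀ ℤ.≤ e₁ → a₁ ℤ.< w → ((u *L Q₀) +L (v *L Q₁)) ≈L Q →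
    ∃ λ t → HasValuation ((u *L E₀) +L (v *L E₁)) t × t ℤ.≤ e₀
  combination-valuation u v Q₀ Q₁ E₀ E₁ Q a₀ a₁ e₀ e₁ w pu pv Q₀∼a₀ Q₁∼a₁ E₀∼e₀ E₁∼e₁ Q∼w
                        a₁<a₀ e₀≤e₁ a₁<w uQ₀+vQ₁≈Q with polynomial-≈0L⊎valuation v pv
  ... | inj₁ v≈0 = dominant-term u E₀ (v *L E₁) e₀ pu u≉0 E₀∼e₀ λ _ _ →
          valAtLeast-cong (≈L-sym (un≋ (0*≈0 v E₁ (mk≋ v≈0)))) (valAtLeast-0L _)
    where
    u≉0 : ¬ (u ≈L 0L)
    u≉0 u≈0 = hasValuation⇒≉0L Q∼w (≈L-trans (≈L-sym (un≋ uQ₀≈Q)) (un≋ (0*≈0 u Q₀ (mk≋ u≈0))))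
      where
      uQ₀≈Q : (u *L Q₀) ≋ Q
      uQ₀≈Q = x+0≈z (u *L Q₀) (v *L Q₁) Q (mk≋ uQ₀+vQ₁≈Q) (0*≈0 v Q₁ (mk≋ v≈0))
  ... | inj₂ (b , v∼b) = dominant-term u E₀ (v *L E₁) e₀ pu u≉0 E₀∼e₀ vE₁-small
    where
    uQ₀≈Q-vQ₁ : (u *L Q₀) ≈L ((-L (v *L Q₁)) +L Q)
    uQ₀≈Q-vQ₁ = un≋ (+≈⇒≈-+ (u *L Q₀) (v *L Q₁) Q (mk≋ uQ₀+vQ₁≈Q))
    Q-vQ₁∼b+a₁ : HasValuation ((-L (v *L Q₁)) +L Q) (b ℤ.+ a₁)
    Q-vQ₁∼b+a₁ = hasValuation-+ (hasValuation-neg (hasValuation-* v∼b Q₁∼a₁))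
      (valAtLeast-weaken (i<j⇒i+1≤j (ℤP.≤-<-trans (i≤0⇒i+j≤j b a₁ (polynomial-valuation≤0 v∼b pv)) a₁<w))
                         (proj₂ Q∼w))
    u≉0 : ¬ (u ≈L 0L)
    u≉0 u≈0 = hasValuation⇒≉0L Q-vQ₁∼b+a₁
      (≈L-trans (≈L-sym uQ₀≈Q-vQ₁) (un≋ (0*≈0 u Q₀ (mk≋ u≈0))))
    vE₁-small : ∀ a → HasValuation u a → ValAtLeast (v *L E₁) ((a ℤ.+ e₀) ℤ.+ + 1)
    vE₁-small a u∼a = valAtLeast-weaken (i<j⇒i+1≤j a+e₀<b+e₁) (proj₂ (hasValuation-* v∼b E₁∼e₁))
      where
      a+a₀≡b+a₁ : a ℤ.+ a₀ ≡ b ℤ.+ a₁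
      a+a₀≡b+a₁ = hasValuation-unique (hasValuation-* u∼a Q₀∼a₀)
                                      (hasValuation-cong (≈L-sym uQ₀≈Q-vQ₁) Q-vQ₁∼b+a₁)
      swap : ∀ (x y z : ℤ) → (x ℤ.+ z) ℤ.+ y ≡ (x ℤ.+ y) ℤ.+ z
      swap = solve-∀
      a+e₀<b+e₁ : a ℤ.+ e₀ ℤ.< b ℤ.+ e₁
      a+e₀<b+e₁ = +-cancelʳ-<ℤ a₀ (≡.subst₂ ℤ._<_ (swap a e₀ a₀) (swap b e₁ a₀)
        (ℤP.<-≤-trans (≡.subst (ℤ._< (b ℤ.+ a₀) ℤ.+ e₀) (≡.cong (ℤ._+ e₀) (≡.sym a+a₀≡b+a₁))
                                (ℤP.+-monoˡ-< e₀ (ℤP.+-monoʳ-< b a₁<a₀)))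
                      (ℤP.+-monoʳ-≤ (b ℤ.+ a₀) e₀≤e₁)))

  module Expansion (α : Laurent) (αs : ℕ → Laurent) (cq : CompleteQuotients α αs) where
    open CF αs

    β : ℕ → Laurent
    β k = frac (αs k)

    αs≈A+β : ∀ k → αs k ≈L (A k +L β k)
    αs≈A+β k = intPart+frac (αs k)

    αs*β≈1 : ∀ k → (αs (suc k) *L β k) ≈L 1L
    αs*β≈1 = proj₂ cq

    A-polynomial : ∀ k → IsPolynomial (A k)
    A-polynomial k = intPart-polynomial (αs k)

    private
      β-valuation-positive : ∀ k → ∃ (HasValuation (β k)) → ∃ λ ν → 1 ≤ ν × HasValuation (β k) (+ ν)
      β-valuation-positive k (+ suc ν , β∼ν) = suc ν , s≤s z≤n , β∼ν
      β-valuation-positive k (+ zero , (β₀≉0 , _)) =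
        ⊥-elim (β₀≉0 (frac-coeff-nonpos (αs k) (+ 0) (ℤ.+≤+ z≤n)))
      β-valuation-positive k (-[1+ n ] , (βi≉0 , _)) =
        ⊥-elim (βi≉0 (frac-coeff-nonpos (αs k) -[1+ n ] ℤ.-≤+))

    -- ν k = deg A_{k+1} = −v(β k).  Abstract, so that the valuation search is never unfolded.
    abstract
      β-valuation : ∀ k → ∃ λ ν → 1 ≤ ν × HasValuation (β k) (+ ν)
      β-valuation k = β-valuation-positive k (hasValuation-exists (β k)
        (*L-≉0⇒≉0ʳ (αs (suc k)) (β k) (+ 0) (λ e → 1≉0 (trans (sym (αs*β≈1 k (+ 0))) e))))

    ν : ℕ → ℕ
    ν k = proj₁ (β-valuation k)

    1≤ν : ∀ k → 1 ≤ ν k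
    1≤ν k = proj₁ (proj₂ (β-valuation k))

    β∼ν : ∀ k → HasValuation (β k) (+ ν k)
    β∼ν k = proj₂ (proj₂ (β-valuation k))

    private
      αs-valuation : ∀ k → ∃ (HasValuation (αs (suc k))) → HasValuation (αs (suc k)) (ℤ.- + ν k)
      αs-valuation k (u , αs∼u) = ≡.subst (HasValuation (αs (suc k))) (u≡-ν (hasValuation-unique
          (hasValuation-cong (αs*β≈1 k) (hasValuation-* αs∼u (β∼ν k))) hasValuation-1L)) αs∼u
        where
        u≡-ν : u ℤ.+ + ν k ≡ + 0 → u ≡ ℤ.- + ν k
        u≡-ν eq = ≡.trans (≡.sym (n+m-m≡n u (+ ν k)))
                          (≡.trans (≡.cong (ℤ._- + ν k) eq) (ℤP.+-identityˡ (ℤ.- + ν k)))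

    αs∼-ν : ∀ k → HasValuation (αs (suc k)) (ℤ.- + ν k)
    αs∼-ν k = αs-valuation k (hasValuation-exists (αs (suc k))
      (*L-≉0⇒≉0ˡ (αs (suc k)) (β k) (+ 0) (λ e → 1≉0 (trans (sym (αs*β≈1 k (+ 0))) e))))

    A∼-ν : ∀ k → HasValuation (A (suc k)) (ℤ.- + ν k)
    A∼-ν k = (λ A≈0 → proj₁ (αs∼-ν k) (trans (sym (intPart-coeff-nonpos (αs (suc k)) _ (-n≤0 (ν k)))) A≈0)) ,
             λ i i<-ν → trans (intPart-coeff-nonpos (αs (suc k)) i (ℤP.<⇒≤ (ℤP.<-≤-trans i<-ν (-n≤0 (ν k)))))
                              (proj₂ (αs∼-ν k) i i<-ν)

    degQ : ℕ → ℕ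
    degQ zero    = 0
    degQ (suc k) = degQ k ℕ.+ ν k

    degQ-< : ∀ k → degQ k < degQ (suc k)
    degQ-< k = ≡.subst (_≤ degQ k ℕ.+ ν k) (ℕP.+-comm (degQ k) 1) (ℕP.+-monoʳ-≤ (degQ k) (1≤ν k))

    -degQ-< : ∀ k → ℤ.- + degQ (suc k) ℤ.< ℤ.- + degQ k
    -degQ-< k = ℤP.neg-mono-< (ℤ.+<+ (degQ-< k))

    Q′ : ℕ → Laurent
    Q′ k = proj₁ (QQ k)

    private
      QQ-invariant : ∀ k → IsPolynomial (Q′ k) × IsPolynomial (Q k) ×
                           ValAtLeast (Q′ k) (ℤ.- + degQ k) × HasValuation (Q k) (ℤ.- + degQ k)
      QQ-invariant zero = polynomial-0L , polynomial-1L , valAtLeast-0L _ , hasValuation-1L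
      QQ-invariant (suc k) with QQ-invariant k
      ... | pQ′ , pQ , Q′≥ , Q∼ =
        pQ , polynomial-+ _ _ (polynomial-* _ _ (A-polynomial (suc k)) pQ) pQ′ ,
        valAtLeast-weaken (ℤP.<⇒≤ (-degQ-< k)) (proj₂ Q∼) ,
        hasValuation-+ (≡.subst (HasValuation (A (suc k) *L Q k)) (-ν-d≡ (+ ν k) (+ degQ k))
                                (hasValuation-* (A∼-ν k) Q∼))
                       (valAtLeast-weaken (i<j⇒i+1≤j (-degQ-< k)) Q′≥)
        where
        -ν-d≡ : ∀ (w d : ℤ) → ℤ.- w ℤ.+ ℤ.- d ≡ ℤ.- (d ℤ.+ w)
        -ν-d≡ = solve-∀

    Q′-polynomial : ∀ k → IsPolynomial (Q′ k)
    Q′-polynomial k = proj₁ (QQ-invariant k)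

    Q-polynomial : ∀ k → IsPolynomial (Q k)
    Q-polynomial k = proj₁ (proj₂ (QQ-invariant k))

    Q∼-degQ : ∀ k → HasValuation (Q k) (ℤ.- + degQ k)
    Q∼-degQ k = proj₂ (proj₂ (proj₂ (QQ-invariant k)))

    PP EE : ℕ → Laurent × Laurent
    PP zero    = 1L , A 0
    PP (suc k) = proj₂ (PP k) , ((A (suc k) *L proj₂ (PP k)) +L proj₁ (PP k))
    EE zero    = (-L 1L) , β 0
    EE (suc k) = proj₂ (EE k) , ((A (suc k) *L proj₂ (EE k)) +L proj₁ (EE k))

    P′ P E′ E : ℕ → Laurent
    P′ k = proj₁ (PP k)
    P  k = proj₂ (PP k)
    E′ k = proj₁ (EE k)
    E  k = proj₂ (EE k)

    private
      PP-polynomial : ∀ k → IsPolynomial (P′ k) × IsPolynomial (P k)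
      PP-polynomial zero    = polynomial-1L , A-polynomial 0
      PP-polynomial (suc k) with PP-polynomial k
      ... | pP′ , pP = pP , polynomial-+ _ _ (polynomial-* _ _ (A-polynomial (suc k)) pP) pP′

    P′-polynomial : ∀ k → IsPolynomial (P′ k)
    P′-polynomial k = proj₁ (PP-polynomial k)

    P-polynomial : ∀ k → IsPolynomial (P k)
    P-polynomial k = proj₂ (PP-polynomial k)

    Qα≈P+E : ∀ k → ((Q′ k *L α) ≈L (P′ k +L E′ k)) × ((Q k *L α) ≈L (P k +L E k))
    Qα≈P+E zero = un≋ (𝕃.trans (𝕃.zeroˡ α) (𝕃.sym (𝕃.-‿inverseʳ 1L))) ,
                  ≈L-trans (*L-identityˡ α) (≈L-trans (≈L-sym (proj₁ cq)) (αs≈A+β 0))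
    Qα≈P+E (suc k) with Qα≈P+E k
    ... | Q′α , Qα = Qα , un≋ (approximation-step (A (suc k)) (Q k) (Q′ k) α (P k) (P′ k) (E k) (E′ k)
                                                  (mk≋ Qα) (mk≋ Q′α))

    E+βE′≈0 : ∀ k → (E k +L (β k *L E′ k)) ≈L 0L
    E+βE′≈0 zero    = un≋ (begin
      β 0 +L (β 0 *L (-L 1L))  ≈⟨ 𝕃.+-congˡ (𝕃.sym (-‿distribʳ-* (β 0) 1L)) ⟩
      β 0 +L (-L (β 0 *L 1L))  ≈⟨ 𝕃.+-congˡ (𝕃.-‿cong (𝕃.*-identityʳ (β 0))) ⟩
      β 0 +L (-L β 0)          ≈⟨ 𝕃.-‿inverseʳ (β 0) ⟩
      0L                       ∎)
      where
      open import Relation.Binary.Reasoning.Setoid 𝕃.setoid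
    E+βE′≈0 (suc k) = un≋ (error-step (A (suc k)) (β (suc k)) (αs (suc k)) (β k) (E k) (E′ k)
                                      (mk≋ (E+βE′≈0 k)) (mk≋ (αs*β≈1 k)) (mk≋ (αs≈A+β (suc k))))

    E∼degQ : ∀ k → HasValuation (E k) (+ degQ (suc k))
    E∼degQ zero    = β∼ν 0
    E∼degQ (suc k) = hasValuation-cong (≈L-sym (un≋ (+-inverseˡ-unique (E (suc k)) (β (suc k) *L E k)
                                                     (mk≋ (E+βE′≈0 (suc k))))))
      (hasValuation-neg (≡.subst (HasValuation (β (suc k) *L E k)) (≡.cong +_ (ℕP.+-comm (ν (suc k)) (degQ (suc k))))
                                 (hasValuation-* (β∼ν (suc k)) (E∼degQ k))))

    Determinant : ℕ → Set
    Determinant k = ((Q′ k *L P k) ≈L ((P′ k *L Q k) +L 1L)) ⊎ ((P′ k *L Q k) ≈L ((Q′ k *L P k) +L 1L))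

    determinant : ∀ k → Determinant k
    determinant zero = inj₂ (un≋ (𝕃.trans (𝕃.*-identityˡ 1L)
      (𝕃.sym (𝕃.trans (𝕃.+-congʳ (𝕃.zeroˡ (A 0))) (𝕃.+-identityˡ 1L)))))
    determinant (suc k) with determinant k
    ... | inj₁ det = inj₂ (un≋ (determinant-step (A (suc k)) (Q′ k) (P′ k) (Q k) (P k) (mk≋ det)))
    ... | inj₂ det = inj₁ (un≋ (determinant-step (A (suc k)) (P′ k) (Q′ k) (P k) (Q k) (mk≋ det)))

    record Coordinates (k : ℕ) (R S : Laurent) : Set where
      field
        u v       : Laurent
        u-poly    : IsPolynomial u
        v-poly    : IsPolynomial v
        Q-combination : ((u *L Q′ k) +L (v *L Q k)) ≋ R
        P-combination : ((u *L P′ k) +L (v *L P k)) ≋ S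

    private
      cross-polynomial : ∀ a b c d → IsPolynomial a → IsPolynomial b → IsPolynomial c → IsPolynomial d →
                         IsPolynomial ((a *L b) +L ((-L c) *L d))
      cross-polynomial a b c d pa pb pc pd =
        polynomial-+ _ _ (polynomial-* a b pa pb) (polynomial-* (-L c) d (polynomial-neg c pc) pd)

    coordinates : ∀ k R S → IsPolynomial R → IsPolynomial S → Coordinates k R S
    coordinates k R S pR pS with determinant k
    ... | inj₁ det = record
      { u = (R *L P k) +L ((-L S) *L Q k) ; v = (S *L Q′ k) +L ((-L R) *L P′ k)
      ; u-poly = cross-polynomial R (P k) S (Q k) pR (P-polynomial k) pS (Q-polynomial k)
      ; v-poly = cross-polynomial S (Q′ k) R (P′ k) pS (Q′-polynomial k) pR (P′-polynomial k)
      ; Q-combination = proj₁ (unimodular-solve R S (-L R) (-L S) (Q′ k) (P′ k) (Q k) (P k)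
                                 (𝕃.-‿inverseʳ R) (𝕃.-‿inverseʳ S) (mk≋ det))
      ; P-combination = proj₂ (unimodular-solve R S (-L R) (-L S) (Q′ k) (P′ k) (Q k) (P k)
                                 (𝕃.-‿inverseʳ R) (𝕃.-‿inverseʳ S) (mk≋ det)) }
    ... | inj₂ det = record
      { u = (S *L Q k) +L ((-L R) *L P k) ; v = (R *L P′ k) +L ((-L S) *L Q′ k)
      ; u-poly = cross-polynomial S (Q k) R (P k) pS (Q-polynomial k) pR (P-polynomial k)
      ; v-poly = cross-polynomial R (P′ k) S (Q′ k) pR (P′-polynomial k) pS (Q′-polynomial k)
      ; Q-combination = proj₂ (unimodular-solve S R (-L S) (-L R) (P′ k) (Q′ k) (P k) (Q k)
                                 (𝕃.-‿inverseʳ S) (𝕃.-‿inverseʳ R) (mk≋ det))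
      ; P-combination = proj₁ (unimodular-solve S R (-L S) (-L R) (P′ k) (Q′ k) (P k) (Q k)
                                 (𝕃.-‿inverseʳ S) (𝕃.-‿inverseʳ R) (mk≋ det)) }

    best-approximation : ∀ k R w → IsPolynomial R → HasValuation R w → ℤ.- + degQ (suc k) ℤ.< w →
      ∀ S T → IsPolynomial S → (R *L α) ≈L (S +L T) → ∃ λ t → HasValuation T t × t ℤ.≤ + degQ (suc k)
    best-approximation k R w pR R∼w deg<deg S T pS Rα≈S+T = transfer
      (combination-valuation u v (Q k) (Q (suc k)) (E k) (E (suc k)) R
         (ℤ.- + degQ k) (ℤ.- + degQ (suc k)) (+ degQ (suc k)) (+ degQ (suc (suc k))) w
         u-poly v-poly (Q∼-degQ k) (Q∼-degQ (suc k)) (E∼degQ k) (E∼degQ (suc k)) R∼w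
         (-degQ-< k) (ℤ.+≤+ (ℕP.<⇒≤ (degQ-< (suc k)))) deg<deg (un≋ Q-combination))
      where
      open Coordinates (coordinates (suc k) R S pR pS)
      T≈ : ((u *L E k) +L (v *L E (suc k))) ≈L T
      T≈ = un≋ (combination-error u v (Q k) (P k) (E k) (Q (suc k)) (P (suc k)) (E (suc k)) R S T α
                  (mk≋ (proj₁ (Qα≈P+E (suc k)))) (mk≋ (proj₂ (Qα≈P+E (suc k)))) (mk≋ Rα≈S+T)
                  Q-combination P-combination)
      transfer : (∃ λ t → HasValuation ((u *L E k) +L (v *L E (suc k))) t × t ℤ.≤ + degQ (suc k)) →
                 ∃ λ t → HasValuation T t × t ℤ.≤ + degQ (suc k)
      transfer (t , uE+vE∼t , t≤) = t , hasValuation-cong T≈ uE+vE∼t , t≤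

module Norms (F : FiniteField) where
  open FiniteField F hiding (zero)
  open LaurentSeries F
  open Valuation F
  open Polynomials F
  open ContinuedFractions F

  2≤q : 2 ≤ q
  2≤q = two-elements q enum enum-inj (proj₁ (enum-sur 0#)) (proj₁ (enum-sur 1#))
                     (proj₂ (enum-sur 0#)) (proj₂ (enum-sur 1#))
    where
    two-elements : ∀ n (e : Fin n → Carrier) → (∀ i j → e i ≈ e j → i ≡ j) →
                   (i j : Fin n) → e i ≈ 0# → e j ≈ 1# → 2 ≤ n
    two-elements (suc (suc n)) _ _ _ _ _ _ = s≤s (s≤s z≤n)
    two-elements (suc zero) e inj Fin.zero Fin.zero e0≈0 e0≈1 = ⊥-elim (1≉0 (trans (sym e0≈1) e0≈0))

  instance
    q-nonZero : ℕ.NonZero q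
    q-nonZero = ℕ.>-nonZero (ℕP.≤-trans (s≤s z≤n) 2≤q)

  private
    a≤a*q^n : ∀ a n → a ≤ a ℕ.* q ^ n
    a≤a*q^n a n = ≡.subst (_≤ a ℕ.* q ^ n) (ℕP.*-identityʳ a) (ℕP.*-monoʳ-≤ a (ℕP.m^n>0 q n))

  QPowLe-weaken : ∀ {e e′} a b → e′ ℤ.≤ e → QPowLe e a b → QPowLe e′ a b
  QPowLe-weaken a b (ℤ.+≤+ n′≤n) le = ℕP.≤-trans (ℕP.*-monoʳ-≤ b (ℕP.^-monoʳ-≤ q n′≤n)) le
  QPowLe-weaken {+ n} { -[1+ n′ ]} a b ℤ.-≤+ le =
    ℕP.≤-trans (a≤a*q^n b n) (ℕP.≤-trans le (a≤a*q^n a (suc n′)))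
  QPowLe-weaken a b (ℤ.-≤- n≤n′) le = ℕP.≤-trans le (ℕP.*-monoʳ-≤ a (ℕP.^-monoʳ-≤ q (s≤s n≤n′)))

  QPowGe-weaken : ∀ {e e′} a b → e ℤ.≤ e′ → QPowGe e a b → QPowGe e′ a b
  QPowGe-weaken a b (ℤ.+≤+ n≤n′) ge = ℕP.≤-trans ge (ℕP.*-monoʳ-≤ b (ℕP.^-monoʳ-≤ q n≤n′))
  QPowGe-weaken { -[1+ n ]} {+ n′} a b ℤ.-≤+ ge =
    ℕP.≤-trans (a≤a*q^n a (suc n)) (ℕP.≤-trans ge (a≤a*q^n b n′))
  QPowGe-weaken a b (ℤ.-≤- n′≤n) ge = ℕP.≤-trans (ℕP.*-monoʳ-≤ a (ℕP.^-monoʳ-≤ q (s≤s n′≤n))) ge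

  QPowLe-neg⇒ : ∀ n a b → 1 ≤ n → QPowLe (ℤ.- + n) a b → b ≤ a ℕ.* q ^ n
  QPowLe-neg⇒ (suc n) a b _ le = le

  QPowLe-neg⇐ : ∀ n a b → 1 ≤ n → b ≤ a ℕ.* q ^ n → QPowLe (ℤ.- + n) a b
  QPowLe-neg⇐ (suc n) a b _ le = le

  module Convergents (α : Laurent) (αs : ℕ → Laurent) (cq : CompleteQuotients α αs) where
    open Expansion α αs cq
    open CF αs using (Q)
    open StrictlyIncreasing degQ degQ-< using (bracket) renaming (n≤f[n] to k≤degQ)

    1≤degQ[1+k] : ∀ k → 1 ≤ degQ (suc k)
    1≤degQ[1+k] k = ℕP.≤-trans (s≤s z≤n) (k≤degQ (suc k))

    ‖Q‖ : ℕ → ℕ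
    ‖Q‖ k = q ^ degQ k

    ‖Q₀‖≡1 : ‖Q‖ 0 ≡ 1
    ‖Q₀‖≡1 = ≡.refl

    ‖Q‖-double : ∀ k → 2 ℕ.* ‖Q‖ k ≤ ‖Q‖ (suc k)
    ‖Q‖-double k = ℕP.≤-trans (ℕP.*-monoˡ-≤ (‖Q‖ k) 2≤q) (ℕP.^-monoʳ-≤ q (degQ-< k))

    NormGe-Q⇔ : ∀ k a → (NormGe (Q k) a 1 → a ≤ ‖Q‖ k) × (a ≤ ‖Q‖ k → NormGe (Q k) a 1)
    NormGe-Q⇔ k a = to , from
      where
      to : NormGe (Q k) a 1 → a ≤ ‖Q‖ k
      to (i , Qi≉0 , ge) = ≡.subst (a ≤_) (ℕP.*-identityˡ (‖Q‖ k))
        (QPowGe-weaken a 1 (≡.subst (ℤ.- i ℤ.≤_) (-‿-‿+ (degQ k))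
                              (ℤP.neg-mono-≤ (hasValuation⇒≤ (Q∼-degQ k) i Qi≉0))) ge)
      from : a ≤ ‖Q‖ k → NormGe (Q k) a 1
      from a≤ = ℤ.- + degQ k , proj₁ (Q∼-degQ k) ,
        ≡.subst (λ e → QPowGe e a 1) (≡.sym (-‿-‿+ (degQ k)))
                (≡.subst (a ≤_) (≡.sym (ℕP.*-identityˡ (‖Q‖ k))) a≤)

    open Density ‖Q‖ ‖Q₀‖≡1 ‖Q‖-double using (GoodAt)

    frac-Qα≈E : ∀ k → frac (Q k *L α) ≈L E k
    frac-Qα≈E k = frac-unique (Q k *L α) (P k) (E k) (proj₂ (Qα≈P+E k)) (P-polynomial k)
                    (valAtLeast-weaken (ℤ.+≤+ (1≤degQ[1+k] k)) (proj₂ (E∼degQ k)))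

    goodAt⇒Good : ∀ a b l j → GoodAt a b l j → Good a b α l
    goodAt⇒Good a b l j (Q≤2^l , b2^l≤aQ′) =
      Q j , IsPolynomial⇒IsPoly (Q-polynomial j) , (ℤ.- + degQ j , proj₁ (Q∼-degQ j)) , ‖Q‖≤ , ‖E‖≤
      where
      ‖Q‖≤ : NormLe (Q j) (2 ^ l) 1
      ‖Q‖≤ i Qi≉0 = QPowLe-weaken (2 ^ l) 1
        (≡.subst (ℤ.- i ℤ.≤_) (-‿-‿+ (degQ j)) (ℤP.neg-mono-≤ (hasValuation⇒≤ (Q∼-degQ j) i Qi≉0)))
        (≡.subst (_≤ 2 ^ l) (≡.sym (ℕP.*-identityˡ (‖Q‖ j))) Q≤2^l)
      ‖E‖≤ : NormLe (frac (Q j *L α)) a (b ℕ.* 2 ^ l)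
      ‖E‖≤ i Ei≉0 = QPowLe-weaken a (b ℕ.* 2 ^ l)
        (ℤP.neg-mono-≤ (hasValuation⇒≤ (E∼degQ j) i (λ Ei≈0 → Ei≉0 (trans (frac-Qα≈E j i) Ei≈0))))
        (QPowLe-neg⇐ (degQ (suc j)) a (b ℕ.* 2 ^ l) (1≤degQ[1+k] j) b2^l≤aQ′)

    -- A good witness R of degree e is compared with the convergent Q_j, degQ j ≤ e < degQ (j+1).
    goodAt-of-degree : ∀ a b l R e → IsPolynomial R → HasValuation R (ℤ.- + e) →
                       NormLe R (2 ^ l) 1 → NormLe (frac (R *L α)) a (b ℕ.* 2 ^ l) → ∃ (GoodAt a b l)
    goodAt-of-degree a b l R e pR R∼-e ‖R‖≤ ‖fracRα‖≤ = j , ‖Q‖≤2^l , b2^l≤a‖Q‖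
      where
      j : ℕ
      j = proj₁ (bracket e z≤n)
      degQj≤e : degQ j ≤ e
      degQj≤e = proj₁ (proj₂ (bracket e z≤n))
      e<degQj+1 : e < degQ (suc j)
      e<degQj+1 = proj₂ (proj₂ (bracket e z≤n))
      far : ∃ λ t → HasValuation (frac (R *L α)) t × t ℤ.≤ + degQ (suc j)
      far = best-approximation j R (ℤ.- + e) pR R∼-e (ℤP.neg-mono-< (ℤ.+<+ e<degQj+1))
              (intPart (R *L α)) (frac (R *L α)) (intPart-polynomial (R *L α)) (intPart+frac (R *L α))
      q^e≤2^l : q ^ e ≤ 2 ^ l
      q^e≤2^l = ≡.subst (_≤ 2 ^ l) (ℕP.*-identityˡ (q ^ e))
        (≡.subst (λ i → QPowLe i (2 ^ l) 1) (-‿-‿+ e) (‖R‖≤ (ℤ.- + e) (proj₁ R∼-e)))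
      ‖Q‖≤2^l : ‖Q‖ j ≤ 2 ^ l
      ‖Q‖≤2^l = ℕP.≤-trans (ℕP.^-monoʳ-≤ q degQj≤e) q^e≤2^l
      b2^l≤a‖Q‖ : b ℕ.* 2 ^ l ≤ a ℕ.* ‖Q‖ (suc j)
      b2^l≤a‖Q‖ = QPowLe-neg⇒ (degQ (suc j)) a (b ℕ.* 2 ^ l) (1≤degQ[1+k] j)
        (QPowLe-weaken a (b ℕ.* 2 ^ l) (ℤP.neg-mono-≤ (proj₂ (proj₂ far)))
                       (‖fracRα‖≤ (proj₁ far) (proj₁ (proj₁ (proj₂ far)))))

    Good⇒goodAt : ∀ a b l → Good a b α l → ∃ (GoodAt a b l)
    Good⇒goodAt a b l (R , pR , R≉0 , ‖R‖≤ , ‖fracRα‖≤) = from-valuation (hasValuation-exists R R≉0)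
      where
      from-valuation : ∃ (HasValuation R) → ∃ (GoodAt a b l)
      from-valuation (w , R∼w) with ≤0⇒≡-n w (polynomial-valuation≤0 R∼w (IsPoly⇒IsPolynomial pR))
      ... | e , ≡.refl = goodAt-of-degree a b l R e (IsPoly⇒IsPolynomial pR) R∼w ‖R‖≤ ‖fracRα‖≤

theorem10p1 : (F : FiniteField) → let open LaurentSeries F in
    (α : Laurent) → Irrational α →
    (αs : ℕ → Laurent) → CompleteQuotients α αs →
    (SingularOnAverage α → RootTendsToInfinity (CF.Q αs)) ×
    (RootTendsToInfinity (CF.Q αs) → SingularOnAverage α)
theorem10p1 F α _ αs cq = singular⇒root , root⇒singular
  where
  open LaurentSeries F
  open Norms F
  open Convergents α αs cq
  open Density ‖Q‖ ‖Q₀‖≡1 ‖Q‖-double using (superExponential⇒denselyGood; denselyGood⇒superExponential)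

  singular⇒root : SingularOnAverage α → RootTendsToInfinity (CF.Q αs)
  singular⇒root singular M with denselyGood⇒superExponential (λ a b l → Good a b α l) Good⇒goodAt singular M
  ... | K , large = K , λ k K≤k → proj₂ (NormGe-Q⇔ k _) (large k K≤k)

  root⇒singular : RootTendsToInfinity (CF.Q αs) → SingularOnAverage α
  root⇒singular root = superExponential⇒denselyGood (λ a b l → Good a b α l) goodAt⇒Good
    λ M → proj₁ (root M) , λ k K≤k → proj₁ (NormGe-Q⇔ k _) (proj₂ (root M) k K≤k)
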